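{- Let $d\geq2$ and $m$ be positive integers, and let $$\Delta=\mathrm{conv}\Big\{\mathbf{0},\mathbf{e}_1,\ldots,\mathbf{e}_{d-1},\,md\,\mathbf{e}_d-\sum_{i=1}^{d-1}\mathbf{e}_i\Big\}\subset\mathbb{R}^d$$ (i.e. $\Delta(0,q^{(m)})$ for $q=(-1,\ldots,-1,d)\in\mathbb{Z}^d$). Then $$h^*_{\Delta}(x)=m\sum_{i=1}^dx^i+(1-x^d).$$
   Context: $\mathbf{e}_i$ is the $i$-th unit coordinate vector of $\mathbb{R}^d$ and $\mathbf{0}$ the origin. For a $d$-dimensional integral polytope $\mathcal{P}$ with Ehrhart polynomial $i(\mathcal{P},t)=\#(t\mathcal{P}\cap\mathbb{Z}^d)$, the $h^*$-polynomial is defined by $1+\sum_{t\geq1}i(\mathcal{P},t)x^t=h^*_{\mathcal{P}}(x)/(1-x)^{d+1}$. -}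

module Defs where

open import Data.Nat as ℕ using (ℕ; zero; suc; _∸_; _≤ᵇ_)
open import Data.Nat.Combinatorics using (_C_)
open import Data.Integer as ℤ using (ℤ; +_; -[1+_])
open import Data.Rational as ℚ using (ℚ)
open import Data.Fin using (Fin; zero; suc; toℕ)
import Data.Vec
open import Data.Vec using (Vec; lookup)
open import Data.List using (List; length)
open import Data.List.Membership.Propositional using (_∈_)
open import Data.List.Relation.Unary.Unique.Propositional using (Unique)
open import Data.Bool using (if_then_else_)
open import Data.Product using (Σ; _×_)
open import Function.Bundles using (_⇔_)
open import Relation.Binary.PropositionalEquality using (_≡_)

sumℚ : ∀ {n} → (Fin n → ℚ) → ℚ
sumℚ {zero} f = ℚ.0ℚ
sumℚ {suc n} f = f zero ℚ.+ sumℚ (λ i → f (suc i))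

sumUpTo : ℕ → (ℕ → ℤ) → ℤ
sumUpTo zero f = f 0
sumUpTo (suc n) f = sumUpTo n f ℤ.+ f (suc n)

InDilate : ∀ {d k} → (Fin k → Vec ℤ d) → ℕ → Vec ℤ d → Set
InDilate {d} {k} V t x =
  Σ (Fin k → ℚ) λ λs →
    (∀ j → ℚ.0ℚ ℚ.≤ λs j) ×
    (sumℚ λs ≡ (+ t) ℚ./ 1) ×
    (∀ (i : Fin d) → (lookup x i ℚ./ 1) ≡ sumℚ (λ j → λs j ℚ.* (lookup (V j) i ℚ./ 1)))

LatticeCount : ∀ {d k} → (Fin k → Vec ℤ d) → ℕ → ℕ → Set
LatticeCount {d} V t n =
  Σ (List (Vec ℤ d)) λ xs → Unique xs × (length xs ≡ n) × (∀ x → (x ∈ xs) ⇔ InDilate V t x)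

-- vertices of Δ in ℝ^d: vertex 0 = 0, vertex (j+1) = e_{j+1} for j < d-1,
-- vertex d = m·d·e_d − Σ_{i<d} e_i
ΔVertex : (d m : ℕ) → Fin (suc d) → Vec ℤ d
ΔVertex d m zero = Data.Vec.replicate d (+ 0)
ΔVertex d m (suc j) = Data.Vec.tabulate λ i →
  if suc (toℕ j) ≤ᵇ (d ∸ 1)
  then (if toℕ i ≤ᵇ toℕ j then (if toℕ j ≤ᵇ toℕ i then + 1 else + 0) else + 0)
  else (if suc (toℕ i) ≤ᵇ (d ∸ 1) then -[1+ 0 ] else + (m ℕ.* d))

-- coefficient of x^n in (1-x)^{d+1} · (1 + Σ_{t≥1} i(t) x^t), given i : ℕ → ℕ
-- (a 0 = 1, a t = i t for t ≥ 1)
seqA : (ℕ → ℕ) → ℕ → ℤ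
seqA i zero = + 1
seqA i (suc t) = + i (suc t)

signedBinom : ℕ → ℕ → ℤ
signedBinom d k = (if k ℕ.% 2 ℕ.≡ᵇ 0 then + 1 else -[1+ 0 ]) ℤ.* + ((suc d) C k)

hstarCoeffFromSeries : ℕ → (ℕ → ℕ) → ℕ → ℤ
hstarCoeffFromSeries d i n = sumUpTo n (λ k → signedBinom d k ℤ.* seqA i (n ∸ k))

-- coefficients of m Σ_{i=1}^d x^i + (1 − x^d)
claimedCoeff : (d m : ℕ) → ℕ → ℤ
claimedCoeff d m zero = + 1
claimedCoeff d m (suc n) =
  if suc n ≤ᵇ d
  then (if d ≤ᵇ suc n then + m ℤ.- + 1 else + m)
  else + 0

{-# OPTIONS --safe #-}

-- Let d = e + 1 and M = m·d. In barycentric coordinates with respect to the vertices of Δ a point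
-- x ∈ ℤᵈ has apex weight x_d/M, edge weights x_i + x_d/M (i < d) and origin weight
-- t − Σ_{i<d} x_i − x_d/m, so x ∈ tΔ iff x_d ≥ 0, M·x_i + x_d ≥ 0 and m·Σ_{i<d} x_i + x_d ≤ m·t.
-- Writing x_d ≥ 0 as w + m(p + d·q) with w < m and p < d, the conditions M·x_i + x_d ≥ 0 say
-- exactly that y_i = x_i + q ≥ 0 (as w + m·p < M), and the last one becomes
-- q + Σ y + height(p, w) ≤ t, where height(p, w) = p + [w > 0]. Hence tΔ ∩ ℤᵈ is the disjoint
-- union over (p, w) of copies of the lattice points of a standard d-simplex of size
-- t − height(p, w), so
--   Σₜ i(tΔ) xᵗ = (Σ_{p<d} Σ_{w<m} x^height(p,w)) / (1 − x)^(d+1)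
-- and h* = Σ_{p<d} (xᵖ + (m − 1) xᵖ⁺¹) = m Σ_{i=1}^d xⁱ + 1 − xᵈ. On coefficient sequences,
-- multiplication by 1 − x is the backward difference ∇.

module Submission where

open import Defs
open import Data.Nat using (ℕ; zero; suc)
open import Data.Integer using (ℤ)
open import Data.Fin using (Fin; zero; suc; inject₁; fromℕ)
open import Function using (_∘_)
open import Relation.Binary.PropositionalEquality using (_≡_; _≗_; refl; cong)

shift : {A : Set} → A → ℕ → (ℕ → A) → ℕ → A
shift z zero    f t       = f t
shift z (suc j) f zero    = z
shift z (suc j) f (suc t) = shift z j f t

shift-cong : ∀ {A : Set} {z : A} j {f g : ℕ → A} → f ≗ g → shift z j f ≗ shift z j g
shift-cong zero    f≗g t       = f≗g t
shift-cong (suc j) f≗g zero    = refl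
shift-cong (suc j) f≗g (suc t) = shift-cong j f≗g t

shift-natural : ∀ {A B : Set} (g : A → B) {z : A} j (f : ℕ → A) t →
  g (shift z j f t) ≡ shift (g z) j (g ∘ f) t
shift-natural g zero    f t       = refl
shift-natural g (suc j) f zero    = refl
shift-natural g (suc j) f (suc t) = shift-natural g j f t

shift-preserves : {A : Set} (P : A → Set) {z : A} {f : ℕ → A} →
  P z → (∀ n → P (f n)) → ∀ j t → P (shift z j f t)
shift-preserves P Pz Pf zero    t       = Pf t
shift-preserves P Pz Pf (suc j) zero    = Pz
shift-preserves P Pz Pf (suc j) (suc t) = shift-preserves P Pz Pf j t

infixl 5 _∷ʳ_

_∷ʳ_ : ∀ {A : Set} {n} → (Fin n → A) → A → Fin (suc n) → A
_∷ʳ_ {n = zero}  f a zero    = a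
_∷ʳ_ {n = suc n} f a zero    = f zero
_∷ʳ_ {n = suc n} f a (suc i) = ((f ∘ suc) ∷ʳ a) i

∷ʳ-inject₁ : ∀ {A : Set} {n} (f : Fin n → A) a i → (f ∷ʳ a) (inject₁ i) ≡ f i
∷ʳ-inject₁ {n = suc n} f a zero    = refl
∷ʳ-inject₁ {n = suc n} f a (suc i) = ∷ʳ-inject₁ (f ∘ suc) a i

∷ʳ-fromℕ : ∀ {A : Set} {n} (f : Fin n → A) a → (f ∷ʳ a) (fromℕ n) ≡ a
∷ʳ-fromℕ {n = zero}  f a = refl
∷ʳ-fromℕ {n = suc n} f a = ∷ʳ-fromℕ (f ∘ suc) a

height : ℕ → ℕ → ℕ
height p zero    = p
height p (suc w) = suc p

module NatArithmetic where
  open import Data.Nat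
  open import Data.Nat.Properties
  open import Data.Nat.DivMod using (_%_; [m+kn]%n≡m%n; m<n⇒m%n≡m)
  open import Data.Product using (_×_; _,_)
  open import Data.Bool using (true; false; T)
  open import Data.Bool.Properties using (T-≡)
  open import Function.Bundles using (_⇔_; mk⇔; Equivalence)
  open import Relation.Nullary using (contradiction)
  open import Relation.Binary.PropositionalEquality

  +-*-injective : ∀ n .{{_ : NonZero n}} {a a′ b b′} → b < n → b′ < n →
    b + a * n ≡ b′ + a′ * n → b ≡ b′ × a ≡ a′
  +-*-injective n {a} {a′} {b} {b′} b<n b′<n eq = b≡b′ , *-cancelʳ-≡ a a′ n (+-cancelˡ-≡ b _ _ eq′)
    where
    b≡b′ : b ≡ b′
    b≡b′ = begin
      b                 ≡⟨ m<n⇒m%n≡m b<n ⟨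
      b % n             ≡⟨ [m+kn]%n≡m%n b a n ⟨
      (b + a * n) % n   ≡⟨ cong (_% n) eq ⟩
      (b′ + a′ * n) % n ≡⟨ [m+kn]%n≡m%n b′ a′ n ⟩
      b′ % n            ≡⟨ m<n⇒m%n≡m b′<n ⟩
      b′                ∎
      where open ≡-Reasoning
    eq′ : b + a * n ≡ b + a′ * n
    eq′ = trans eq (cong (_+ a′ * n) (sym b≡b′))

  ≤ᵇ-true : ∀ {m n} → m ≤ n → (m ≤ᵇ n) ≡ true
  ≤ᵇ-true m≤n = Equivalence.to T-≡ (≤⇒≤ᵇ m≤n)

  ≤ᵇ-false : ∀ {m n} → n < m → (m ≤ᵇ n) ≡ false
  ≤ᵇ-false {m} {n} n<m with m ≤ᵇ n in eq
  ... | false = refl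
  ... | true  = contradiction (≤ᵇ⇒≤ m n (subst T (sym eq) _)) (<⇒≱ n<m)

  height-+ : ∀ s p w → height (s + p) w ≡ s + height p w
  height-+ s p zero    = refl
  height-+ s p (suc w) = sym (+-suc s p)

  m+n≤o⇔n≤o×m≤o∸n : ∀ m {n o} → m + n ≤ o ⇔ (n ≤ o × m ≤ o ∸ n)
  m+n≤o⇔n≤o×m≤o∸n m = mk⇔
    (λ m+n≤o → ≤-trans (m≤n+m _ m) m+n≤o , m+n≤o⇒m≤o∸n m m+n≤o)
    (λ (n≤o , m≤o∸n) → m≤o∸n⇒m+n≤o m n≤o m≤o∸n)

  +-*-≤-*⇔height-≤ : ∀ {m a w t} .{{_ : NonZero m}} → w < m → (w + a * m ≤ t * m ⇔ height a w ≤ t)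
  +-*-≤-*⇔height-≤ {m} {a} {zero}  {t} _   = mk⇔ (*-cancelʳ-≤ a t m) (*-monoˡ-≤ m)
  +-*-≤-*⇔height-≤ {m} {a} {suc w} {t} w<m = mk⇔
    (λ le → *-cancelʳ-< _ a t (<-≤-trans (m<n+m (a * m) z<s) le))
    (λ a<t → ≤-trans (+-monoˡ-≤ (a * m) (<⇒≤ w<m)) (*-monoˡ-≤ m a<t))

module IntArithmetic where
  open import Data.Nat as ℕ using (ℕ)
  open import Data.Integer
  open import Data.Integer.Properties
  open import Data.Integer.Tactic.RingSolver using (solve-∀)
  open import Relation.Nullary using (contradiction)
  open import Relation.Binary.PropositionalEquality

  pos-+-* : ∀ a b c → + (a ℕ.+ b ℕ.* c) ≡ + a + + b * + c
  pos-+-* a b c = trans (pos-+ a (b ℕ.* c)) (cong (λ z → + a + z) (pos-* b c))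

  i+j-j≡i : ∀ i j → i + j - j ≡ i
  i+j-j≡i = solve-∀

  i-j+j≡i : ∀ i j → i - j + j ≡ i
  i-j+j≡i = solve-∀

  0≤n*i+r⇒0≤i : ∀ {n r} i → r ℕ.< n → + 0 ≤ + n * i + + r → + 0 ≤ i
  0≤n*i+r⇒0≤i (+ _)      _   _  = +≤+ ℕ.z≤n
  0≤n*i+r⇒0≤i {n} {r} -[1+ k ] r<n 0≤ = contradiction 0≤ (<⇒≱ (begin-strict
    + n * -[1+ k ] + + r   ≤⟨ +-monoˡ-≤ (+ r) (*-monoˡ-≤-nonNeg (+ n) (-≤- ℕ.z≤n)) ⟩
    + n * -1ℤ + + r        ≡⟨ cong (_+ + r) (trans (*-comm (+ n) -1ℤ) (-1*i≡-i (+ n))) ⟩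
    - + n + + r            <⟨ +-monoʳ-< (- + n) (+<+ r<n) ⟩
    - + n + + n            ≡⟨ +-inverseˡ (+ n) ⟩
    + 0                    ∎))
    where open ≤-Reasoning

module Rationals where
  open import Data.Nat as ℕ using (zero; suc)
  import Data.Nat.Coprimality as Coprimality
  open import Data.Integer as ℤ using (+_; -[1+_])
  import Data.Integer.Properties as ℤP
  open import Data.Rational using (ℚ; mkℚ; _/_; 0ℚ; 1ℚ; _+_; _*_; -_; _-_; _≤_; *≤*; Positive)
  import Data.Rational.Properties as ℚP
  open import Function using (case_of_)
  open import Function.Bundles using (_⇔_; mk⇔; Equivalence)
  open import Algebra.Bundles using (Ring)
  import Algebra.Properties.Semiring.Sum as SemiringSum
  open SemiringSum ℤP.+-*-semiring using () renaming (sum to ∑ℤ)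
  open SemiringSum (Ring.semiring ℚP.+-*-ring) using (sum)
  open import Relation.Binary.PropositionalEquality

  ι : ℤ → ℚ
  ι z = z / 1

  ι≡mkℚ : ∀ z → ι z ≡ mkℚ z 0 (Coprimality.sym (Coprimality.1-coprimeTo ℤ.∣ z ∣))
  ι≡mkℚ (+ n)    = ℚP.normalize-coprime (Coprimality.sym (Coprimality.1-coprimeTo n))
  ι≡mkℚ -[1+ n ] = cong -_ (ℚP.normalize-coprime (Coprimality.sym (Coprimality.1-coprimeTo (suc n))))

  ι-+ : ∀ a b → ι (a ℤ.+ b) ≡ ι a + ι b
  ι-+ a b = sym (trans (cong₂ _+_ (ι≡mkℚ a) (ι≡mkℚ b))
                       (cong₂ (λ u v → (u ℤ.+ v) / 1) (ℤP.*-identityʳ a) (ℤP.*-identityʳ b)))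

  ι-* : ∀ a b → ι (a ℤ.* b) ≡ ι a * ι b
  ι-* a b = sym (cong₂ _*_ (ι≡mkℚ a) (ι≡mkℚ b))

  ι-≤⇔ : ∀ {a b} → a ℤ.≤ b ⇔ ι a ≤ ι b
  ι-≤⇔ {a} {b} = mk⇔
    (λ a≤b → subst₂ _≤_ (sym (ι≡mkℚ a)) (sym (ι≡mkℚ b))
               (*≤* (subst₂ ℤ._≤_ (sym (ℤP.*-identityʳ a)) (sym (ℤP.*-identityʳ b)) a≤b)))
    (λ ιa≤ιb → case subst₂ _≤_ (ι≡mkℚ a) (ι≡mkℚ b) ιa≤ιb of λ where
      (*≤* a*1≤b*1) → subst₂ ℤ._≤_ (ℤP.*-identityʳ a) (ℤP.*-identityʳ b) a*1≤b*1)

  ι-positive : ∀ n .{{_ : ℕ.NonZero n}} → Positive (ι (+ n))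
  ι-positive (suc n) = subst Positive (sym (ι≡mkℚ (+ suc n))) _

  ι-sum : ∀ {n} (f : Fin n → ℤ) → ι (∑ℤ f) ≡ sum (ι ∘ f)
  ι-sum {zero}  f = refl
  ι-sum {suc n} f = trans (ι-+ (f zero) (∑ℤ (f ∘ suc))) (cong (λ s → ι (f zero) + s) (ι-sum (f ∘ suc)))

  sumℚ≡sum : ∀ {n} (f : Fin n → ℚ) → sumℚ f ≡ sum f
  sumℚ≡sum {zero}  f = refl
  sumℚ≡sum {suc n} f = cong (λ s → f zero + s) (sumℚ≡sum (f ∘ suc))

  ∑-const : ∀ n x → sum {n} (λ _ → x) ≡ ι (+ n) * x
  ∑-const zero    x = sym (ℚP.*-zeroˡ x)
  ∑-const (suc n) x = begin
    x + sum {n} (λ _ → x)      ≡⟨ cong (λ s → x + s) (∑-const n x) ⟩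
    x + ι (+ n) * x            ≡⟨ cong (_+ ι (+ n) * x) (ℚP.*-identityˡ x) ⟨
    1ℚ * x + ι (+ n) * x       ≡⟨ ℚP.*-distribʳ-+ x 1ℚ (ι (+ n)) ⟨
    (1ℚ + ι (+ n)) * x         ≡⟨ cong (_* x) (ι-+ (+ 1) (+ n)) ⟨
    ι (+ suc n) * x            ∎
    where open ≡-Reasoning

  *-≤-*⇔ : ∀ c .{{_ : Positive c}} {a b} → c * a ≤ c * b ⇔ a ≤ b
  *-≤-*⇔ c = mk⇔ (ℚP.*-cancelˡ-≤-pos c) (ℚP.*-monoˡ-≤-nonNeg c {{ℚP.pos⇒nonNeg c}})

  0≤*⇔0≤ : ∀ c .{{_ : Positive c}} {a} → 0ℚ ≤ c * a ⇔ 0ℚ ≤ a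
  0≤*⇔0≤ c {a} = mk⇔
    (λ 0≤ca → to (*-≤-*⇔ c) (subst (_≤ c * a) (sym (ℚP.*-zeroʳ c)) 0≤ca))
    (λ 0≤a → subst (_≤ c * a) (ℚP.*-zeroʳ c) (from (*-≤-*⇔ c) 0≤a))
    where open Equivalence

  ≤⇔0≤- : ∀ {a b} → a ≤ b ⇔ 0ℚ ≤ b - a
  ≤⇔0≤- {a} {b} = mk⇔
    (λ a≤b → subst (_≤ b - a) (ℚP.+-inverseʳ a) (ℚP.+-monoˡ-≤ (- a) a≤b))
    (λ 0≤b-a → subst₂ _≤_ (ℚP.+-identityˡ a) b-a+a≡b (ℚP.+-monoˡ-≤ a 0≤b-a))
    where
    b-a+a≡b : b - a + a ≡ b
    b-a+a≡b = trans (ℚP.+-assoc b (- a) a) (trans (cong (λ s → b + s) (ℚP.+-inverseˡ a)) (ℚP.+-identityʳ b))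

module Enumeration where
  open import Data.Nat as ℕ using (zero; suc; _<_; _∸_; z≤n; s≤s)
  import Data.Nat.Properties as ℕP
  open import Data.Integer using (+_; _+_)
  import Data.Integer.Properties as ℤP
  open import Data.Fin using (toℕ)
  open import Data.List using (List; []; _∷_; [_]; _++_; map; concat; applyUpTo; length)
  open import Data.List.Properties using (length-++; length-map)
  open import Data.List.Membership.Propositional using (_∈_)
  open import Data.List.Membership.Propositional.Properties
    using (∈-map⁺; ∈-map⁻; ∈-++⁺ˡ; ∈-++⁺ʳ; ∈-++⁻; ∈-concat⁺′; ∈-concat⁻′; ∈-applyUpTo⁺; ∈-applyUpTo⁻)
  open import Data.List.Membership.Propositional.Properties.WithK using (unique∧set⇒bag)
  open import Data.List.Relation.Binary.BagAndSetEquality using (∼bag⇒↭)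
  open import Data.List.Relation.Binary.Permutation.Propositional.Properties using (↭-length)
  open import Data.List.Relation.Unary.Any using (here)
  open import Data.List.Relation.Unary.Unique.Propositional using (Unique)
  import Data.List.Relation.Unary.Unique.Propositional.Properties as Unique
  import Data.List.Relation.Unary.All.Properties as All
  import Data.List.Relation.Unary.AllPairs as AllPairs
  import Data.List.Relation.Unary.AllPairs.Properties as AllPairs
  open import Data.Vec using (Vec; []; _∷_; sum)
  open import Data.Vec.Properties using (∷-injectiveʳ)
  open import Data.Product using (∃-syntax; _×_; _,_)
  open import Data.Sum using (inj₁; inj₂)
  open import Relation.Nullary using (¬_)
  open import Function.Bundles using (_⇔_)
  open import Algebra.Properties.Semiring.Sum ℤP.+-*-semiring using (sum-syntax)
  open import Relation.Binary.PropositionalEquality hiding ([_])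

  length-unique-≡ : ∀ {X : Set} {xs ys : List X} → Unique xs → Unique ys →
    (∀ {x} → x ∈ xs ⇔ x ∈ ys) → length xs ≡ length ys
  length-unique-≡ xs! ys! xs⇔ys = ↭-length (∼bag⇒↭ (unique∧set⇒bag xs! ys! xs⇔ys))

  ∈-concat-applyUpTo⁻ : ∀ {X : Set} (g : ℕ → List X) {n x} →
    x ∈ concat (applyUpTo g n) → ∃[ i ] i < n × x ∈ g i
  ∈-concat-applyUpTo⁻ g {n} x∈ =
    let _ , x∈xs , xs∈ = ∈-concat⁻′ (applyUpTo g n) x∈
        i , i<n , xs≡gi = ∈-applyUpTo⁻ g xs∈
    in i , i<n , subst (_ ∈_) xs≡gi x∈xs

  ∈-concat-applyUpTo⁺ : ∀ {X : Set} (g : ℕ → List X) {n i x} →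
    i < n → x ∈ g i → x ∈ concat (applyUpTo g n)
  ∈-concat-applyUpTo⁺ g i<n x∈ = ∈-concat⁺′ x∈ (∈-applyUpTo⁺ g i<n)

  concat-applyUpTo-unique : ∀ {X : Set} (g : ℕ → List X) n →
    (∀ {i} → i < n → Unique (g i)) →
    (∀ {i j x} → i < n → j < n → x ∈ g i → x ∈ g j → i ≡ j) →
    Unique (concat (applyUpTo g n))
  concat-applyUpTo-unique g n g! same-block = Unique.concat⁺
    (All.applyUpTo⁺₁ g n g!)
    (AllPairs.applyUpTo⁺₁ g n λ i<j j<n (x∈gi , x∈gj) →
      ℕP.<⇒≢ i<j (same-block (ℕP.<-trans i<j j<n) j<n x∈gi x∈gj))

  length-concat-applyUpTo : ∀ {X : Set} (g : ℕ → List X) n →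
    + length (concat (applyUpTo g n)) ≡ ∑[ i < n ] (+ length (g (toℕ i)))
  length-concat-applyUpTo g zero    = refl
  length-concat-applyUpTo g (suc n) =
    trans (cong +_ (length-++ (g 0)))
    (trans (ℤP.pos-+ (length (g 0)) _)
           (cong (λ s → + length (g 0) + s) (length-concat-applyUpTo (g ∘ suc) n)))

  ∈-shift⁻ : ∀ {X : Set} j (F : ℕ → List X) t {x} → x ∈ shift [] j F t → j ℕ.≤ t × x ∈ F (t ∸ j)
  ∈-shift⁻ zero    F t       x∈ = z≤n , x∈
  ∈-shift⁻ (suc j) F (suc t) x∈ = let j≤t , x∈F = ∈-shift⁻ j F t x∈ in s≤s j≤t , x∈F

  ∈-shift⁺ : ∀ {X : Set} j (F : ℕ → List X) t {x} → j ℕ.≤ t → x ∈ F (t ∸ j) → x ∈ shift [] j F t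
  ∈-shift⁺ zero    F t       _         x∈ = x∈
  ∈-shift⁺ (suc j) F (suc t) (s≤s j≤t) x∈ = ∈-shift⁺ j F t j≤t x∈

  simplexCount : ℕ → ℕ → ℕ
  simplexCount zero    n       = 1
  simplexCount (suc r) zero    = simplexCount r zero
  simplexCount (suc r) (suc n) = simplexCount r (suc n) ℕ.+ simplexCount (suc r) n

  sucHead : ∀ {r} → Vec ℕ (suc r) → Vec ℕ (suc r)
  sucHead (a ∷ v) = suc a ∷ v

  simplexPoints : (r n : ℕ) → List (Vec ℕ r)
  simplexPoints zero    n       = [ [] ]
  simplexPoints (suc r) zero    = map (0 ∷_) (simplexPoints r zero)
  simplexPoints (suc r) (suc n) =
    map (0 ∷_) (simplexPoints r (suc n)) ++ map sucHead (simplexPoints (suc r) n)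

  ∈-simplexPoints⁻ : ∀ r n {v} → v ∈ simplexPoints r n → sum v ℕ.≤ n
  ∈-simplexPoints⁻ zero    n {[]} _ = z≤n
  ∈-simplexPoints⁻ (suc r) zero v∈ with ∈-map⁻ (0 ∷_) v∈
  ... | u , u∈ , refl = ∈-simplexPoints⁻ r zero u∈
  ∈-simplexPoints⁻ (suc r) (suc n) v∈ with ∈-++⁻ (map (0 ∷_) (simplexPoints r (suc n))) v∈
  ... | inj₁ v∈₀ with u , u∈ , refl ← ∈-map⁻ (0 ∷_) v∈₀ = ∈-simplexPoints⁻ r (suc n) u∈
  ... | inj₂ v∈₊ with a ∷ u , u∈ , refl ← ∈-map⁻ sucHead v∈₊ = s≤s (∈-simplexPoints⁻ (suc r) n u∈)

  ∈-simplexPoints⁺ : ∀ r n (v : Vec ℕ r) → sum v ℕ.≤ n → v ∈ simplexPoints r n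
  ∈-simplexPoints⁺ zero    n       []          _ = here refl
  ∈-simplexPoints⁺ (suc r) zero    (zero ∷ u)  s≤n =
    ∈-map⁺ (0 ∷_) (∈-simplexPoints⁺ r zero u s≤n)
  ∈-simplexPoints⁺ (suc r) (suc n) (zero ∷ u)  s≤n =
    ∈-++⁺ˡ (∈-map⁺ (0 ∷_) (∈-simplexPoints⁺ r (suc n) u s≤n))
  ∈-simplexPoints⁺ (suc r) (suc n) (suc a ∷ u) (s≤s s≤n) =
    ∈-++⁺ʳ (map (0 ∷_) (simplexPoints r (suc n))) (∈-map⁺ sucHead (∈-simplexPoints⁺ (suc r) n (a ∷ u) s≤n))

  simplexPoints-unique : ∀ r n → Unique (simplexPoints r n)
  simplexPoints-unique zero    n       = [] AllPairs.∷ AllPairs.[]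
    where open import Data.List.Relation.Unary.All using ([])
  simplexPoints-unique (suc r) zero    = Unique.map⁺ ∷-injectiveʳ (simplexPoints-unique r zero)
  simplexPoints-unique (suc r) (suc n) = Unique.++⁺
    (Unique.map⁺ ∷-injectiveʳ (simplexPoints-unique r (suc n)))
    (Unique.map⁺ sucHead-injective (simplexPoints-unique (suc r) n))
    head-zero-or-suc
    where
    sucHead-injective : ∀ {u v : Vec ℕ (suc r)} → sucHead u ≡ sucHead v → u ≡ v
    sucHead-injective {a ∷ u} {b ∷ v} refl = refl
    head-zero-or-suc : ∀ {v} →
      ¬ (v ∈ map (0 ∷_) (simplexPoints r (suc n)) × v ∈ map sucHead (simplexPoints (suc r) n))
    head-zero-or-suc (v∈₀ , v∈₊) with ∈-map⁻ (0 ∷_) v∈₀ | ∈-map⁻ sucHead v∈₊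
    ... | _ , _ , refl | a ∷ _ , _ , ()

  length-simplexPoints : ∀ r n → length (simplexPoints r n) ≡ simplexCount r n
  length-simplexPoints zero    n       = refl
  length-simplexPoints (suc r) zero    =
    trans (length-map (0 ∷_) (simplexPoints r zero)) (length-simplexPoints r zero)
  length-simplexPoints (suc r) (suc n) = begin
    length (map (0 ∷_) (simplexPoints r (suc n)) ++ map sucHead (simplexPoints (suc r) n))
      ≡⟨ length-++ (map (0 ∷_) (simplexPoints r (suc n))) ⟩
    length (map (0 ∷_) (simplexPoints r (suc n))) ℕ.+ length (map sucHead (simplexPoints (suc r) n))
      ≡⟨ cong₂ ℕ._+_ (length-map (0 ∷_) (simplexPoints r (suc n))) (length-map sucHead (simplexPoints (suc r) n)) ⟩
    length (simplexPoints r (suc n)) ℕ.+ length (simplexPoints (suc r) n)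
      ≡⟨ cong₂ ℕ._+_ (length-simplexPoints r (suc n)) (length-simplexPoints (suc r) n) ⟩
    simplexCount (suc r) (suc n) ∎
    where open ≡-Reasoning

module Sequences where
  open import Data.Nat as ℕ using (_∸_)
  open import Data.Nat.Combinatorics using (_C_; nCk+nC[k+1]≡[n+1]C[k+1])
  open import Data.Integer using (+_; -[1+_]; _+_; _-_; _*_; -_)
  import Data.Integer.Properties as ℤP
  open import Data.Integer.Tactic.RingSolver using (solve-∀)
  open import Data.Bool using (if_then_else_)
  open import Data.Fin using (Fin; zero; suc; toℕ)
  open import Algebra.Properties.Semiring.Sum ℤP.+-*-semiring
    using (sum; sum-syntax; sum-cong-≗; sum-replicate-zero)
  open import Relation.Binary.PropositionalEquality
  open ≡-Reasoning
  open IntArithmetic using (i+j-j≡i)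
  open Enumeration using (simplexCount)

  sumUpTo-cong : ∀ n {g h} → g ≗ h → sumUpTo n g ≡ sumUpTo n h
  sumUpTo-cong zero    g≗h = g≗h 0
  sumUpTo-cong (suc n) g≗h = cong₂ _+_ (sumUpTo-cong n g≗h) (g≗h (suc n))

  sumUpTo-suc : ∀ n g → sumUpTo (suc n) g ≡ g 0 + sumUpTo n (g ∘ suc)
  sumUpTo-suc zero    g = refl
  sumUpTo-suc (suc n) g =
    trans (cong (_+ g (suc (suc n))) (sumUpTo-suc n g)) (ℤP.+-assoc (g 0) _ _)

  sumUpTo-distrib-sub : ∀ n g h → sumUpTo n (λ k → g k - h k) ≡ sumUpTo n g - sumUpTo n h
  sumUpTo-distrib-sub zero    g h = refl
  sumUpTo-distrib-sub (suc n) g h = trans (cong (_+ (g (suc n) - h (suc n))) (sumUpTo-distrib-sub n g h))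
    (regroup (sumUpTo n g) (sumUpTo n h) (g (suc n)) (h (suc n)))
    where
    regroup : ∀ a b c d → (a - b) + (c - d) ≡ (a + c) - (b + d)
    regroup = solve-∀

  sign : ℕ → ℤ
  sign k = if k ℕ.% 2 ℕ.≡ᵇ 0 then + 1 else -[1+ 0 ]

  sign-suc : ∀ k → sign (suc k) ≡ - sign k
  sign-suc zero          = refl
  sign-suc (suc zero)    = refl
  sign-suc (suc (suc k)) = sign-suc k

  [1-x]^_·_ : ℕ → (ℕ → ℤ) → ℕ → ℤ
  ([1-x]^ c · f) n = sumUpTo n (λ k → sign k * + (c C k) * f (n ∸ k))

  ∇ : (ℕ → ℤ) → ℕ → ℤ
  ∇ f zero    = f zero
  ∇ f (suc n) = f (suc n) - f n

  ∇[_] : ℕ → (ℕ → ℤ) → ℕ → ℤ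
  ∇[ zero ]  f = f
  ∇[ suc c ] f = ∇ (∇[ c ] f)

  [1-x]^0· : ∀ f → [1-x]^ 0 · f ≗ f
  [1-x]^0· f n =
    trans (sumUpTo-vanishing n λ k → cong (_* f (n ∸ suc k)) (ℤP.*-zeroʳ (sign (suc k))))
          (ℤP.*-identityˡ (f n))
    where
    sumUpTo-vanishing : ∀ n {g} → (∀ k → g (suc k) ≡ + 0) → sumUpTo n g ≡ g 0
    sumUpTo-vanishing zero    g0 = refl
    sumUpTo-vanishing (suc n) g0 =
      trans (cong₂ _+_ (sumUpTo-vanishing n g0) (g0 n)) (ℤP.+-identityʳ _)

  [1-x]^suc·-suc : ∀ c f n →
    ([1-x]^ suc c · f) (suc n) ≡ ([1-x]^ c · f) (suc n) - ([1-x]^ c · f) n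
  [1-x]^suc·-suc c f n = begin
    ([1-x]^ suc c · f) (suc n)
      ≡⟨ sumUpTo-suc n _ ⟩
    t₀ + sumUpTo n (λ k → term (suc c) (suc n) (suc k))
      ≡⟨ cong (λ s → t₀ + s) (sumUpTo-cong n pascal) ⟩
    t₀ + sumUpTo n (λ k → term c (suc n) (suc k) - term c n k)
      ≡⟨ cong (λ s → t₀ + s) (sumUpTo-distrib-sub n _ _) ⟩
    t₀ + (sumUpTo n (λ k → term c (suc n) (suc k)) - ([1-x]^ c · f) n)
      ≡⟨ ℤP.+-assoc t₀ _ _ ⟨
    (t₀ + sumUpTo n (λ k → term c (suc n) (suc k))) - ([1-x]^ c · f) n
      ≡⟨ cong (_- ([1-x]^ c · f) n) (sumUpTo-suc n _) ⟨
    ([1-x]^ c · f) (suc n) - ([1-x]^ c · f) n ∎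
    where
    term : ℕ → ℕ → ℕ → ℤ
    term c′ N k = sign k * + (c′ C k) * f (N ∸ k)
    t₀ : ℤ
    t₀ = term c (suc n) 0
    rearrange : ∀ s a b x → - s * (a + b) * x ≡ - s * b * x - s * a * x
    rearrange = solve-∀
    pascal : ∀ k → term (suc c) (suc n) (suc k) ≡ term c (suc n) (suc k) - term c n k
    pascal k = begin
      sign (suc k) * + (suc c C suc k) * f (n ∸ k)
        ≡⟨ cong (λ b → sign (suc k) * + b * f (n ∸ k)) (nCk+nC[k+1]≡[n+1]C[k+1] c k) ⟨
      sign (suc k) * (+ (c C k) + + (c C suc k)) * f (n ∸ k)
        ≡⟨ cong (λ s → s * (+ (c C k) + + (c C suc k)) * f (n ∸ k)) (sign-suc k) ⟩
      - sign k * (+ (c C k) + + (c C suc k)) * f (n ∸ k)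
        ≡⟨ rearrange (sign k) (+ (c C k)) (+ (c C suc k)) (f (n ∸ k)) ⟩
      - sign k * + (c C suc k) * f (n ∸ k) - term c n k
        ≡⟨ cong (λ s → s * + (c C suc k) * f (n ∸ k) - term c n k) (sign-suc k) ⟨
      term c (suc n) (suc k) - term c n k ∎

  [1-x]^·≗∇[] : ∀ c f → [1-x]^ c · f ≗ ∇[ c ] f
  [1-x]^·≗∇[] zero    f n       = [1-x]^0· f n
  [1-x]^·≗∇[] (suc c) f zero    = [1-x]^·≗∇[] c f zero
  [1-x]^·≗∇[] (suc c) f (suc n) = trans ([1-x]^suc·-suc c f n)
    (cong₂ _-_ ([1-x]^·≗∇[] c f (suc n)) ([1-x]^·≗∇[] c f n))

  ∇-cong : ∀ {f g} → f ≗ g → ∇ f ≗ ∇ g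
  ∇-cong f≗g zero    = f≗g zero
  ∇-cong f≗g (suc n) = cong₂ _-_ (f≗g (suc n)) (f≗g n)

  ∇[]-cong : ∀ c {f g} → f ≗ g → ∇[ c ] f ≗ ∇[ c ] g
  ∇[]-cong zero    f≗g = f≗g
  ∇[]-cong (suc c) f≗g = ∇-cong (∇[]-cong c f≗g)

  ∇[suc]≗∇[]∘∇ : ∀ c f → ∇[ suc c ] f ≗ ∇[ c ] (∇ f)
  ∇[suc]≗∇[]∘∇ zero    f _ = refl
  ∇[suc]≗∇[]∘∇ (suc c) f   = ∇-cong (∇[suc]≗∇[]∘∇ c f)

  ∇[]-at-0 : ∀ c f → ∇[ c ] f 0 ≡ f 0
  ∇[]-at-0 zero    f = refl
  ∇[]-at-0 (suc c) f = ∇[]-at-0 c f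

  ∇-+ : ∀ f g → ∇ (λ t → f t + g t) ≗ λ n → ∇ f n + ∇ g n
  ∇-+ f g zero    = refl
  ∇-+ f g (suc n) = regroup (f (suc n)) (g (suc n)) (f n) (g n)
    where
    regroup : ∀ a b c d → (a + b) - (c + d) ≡ (a - c) + (b - d)
    regroup = solve-∀

  ∇[]-+ : ∀ c f g → ∇[ c ] (λ t → f t + g t) ≗ λ n → ∇[ c ] f n + ∇[ c ] g n
  ∇[]-+ zero    f g n = refl
  ∇[]-+ (suc c) f g n = trans (∇-cong (∇[]-+ c f g) n) (∇-+ (∇[ c ] f) (∇[ c ] g) n)

  ∇[]-0 : ∀ c → ∇[ c ] (λ _ → + 0) ≗ λ _ → + 0
  ∇[]-0 zero    n       = refl
  ∇[]-0 (suc c) zero    = ∇[]-0 c zero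
  ∇[]-0 (suc c) (suc n) = cong₂ _-_ (∇[]-0 c (suc n)) (∇[]-0 c n)

  ∇[]-sum : ∀ c {k} (g : Fin k → ℕ → ℤ) →
    ∇[ c ] (λ t → ∑[ i < k ] g i t) ≗ λ n → ∑[ i < k ] ∇[ c ] (g i) n
  ∇[]-sum c {zero}  g n = ∇[]-0 c n
  ∇[]-sum c {suc k} g n = trans (∇[]-+ c (g zero) _ n)
    (cong (λ s → ∇[ c ] (g zero) n + s) (∇[]-sum c (g ∘ suc) n))

  ∇-shift : ∀ j f → ∇ (shift (+ 0) j f) ≗ shift (+ 0) j (∇ f)
  ∇-shift zero    f n             = refl
  ∇-shift (suc j) f zero          = refl
  ∇-shift (suc j) f (suc zero)    = trans (ℤP.+-identityʳ _) (∇-shift j f zero)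
  ∇-shift (suc j) f (suc (suc n)) = ∇-shift j f (suc n)

  ∇[]-shift : ∀ c j f → ∇[ c ] (shift (+ 0) j f) ≗ shift (+ 0) j (∇[ c ] f)
  ∇[]-shift zero    j f n = refl
  ∇[]-shift (suc c) j f n = trans (∇-cong (∇[]-shift c j f) n) (∇-shift j (∇[ c ] f) n)

  impulse : ℕ → ℤ
  impulse zero    = + 1
  impulse (suc n) = + 0

  x^_ : ℕ → ℕ → ℤ
  x^ j = shift (+ 0) j impulse

  ∇-simplexCount : ∀ r → ∇ (+_ ∘ simplexCount (suc r)) ≗ +_ ∘ simplexCount r
  ∇-simplexCount r zero    = refl
  ∇-simplexCount r (suc n) =
    trans (cong (_- + simplexCount (suc r) n) (ℤP.pos-+ (simplexCount r (suc n)) (simplexCount (suc r) n)))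
          (i+j-j≡i (+ simplexCount r (suc n)) (+ simplexCount (suc r) n))

  ∇[]-simplexCount : ∀ r → ∇[ suc r ] (+_ ∘ simplexCount r) ≗ x^ 0
  ∇[]-simplexCount zero    zero    = refl
  ∇[]-simplexCount zero    (suc n) = refl
  ∇[]-simplexCount (suc r) n       = begin
    ∇[ suc (suc r) ] (+_ ∘ simplexCount (suc r)) n ≡⟨ ∇[suc]≗∇[]∘∇ (suc r) _ n ⟩
    ∇[ suc r ] (∇ (+_ ∘ simplexCount (suc r))) n   ≡⟨ ∇[]-cong (suc r) (∇-simplexCount r) n ⟩
    ∇[ suc r ] (+_ ∘ simplexCount r) n             ≡⟨ ∇[]-simplexCount r n ⟩
    (x^ 0) n                                       ∎

  latticeCountFormula : ℕ → ℕ → ℕ → ℤ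
  latticeCountFormula d m t =
    ∑[ p < d ] ∑[ w < m ] shift (+ 0) (height (toℕ p) (toℕ w)) (+_ ∘ simplexCount d) t

  heightPolynomial : ℕ → ℕ → ℕ → ℤ
  heightPolynomial d m n = ∑[ p < d ] ∑[ w < m ] (x^ height (toℕ p) (toℕ w)) n

  ∇[]-latticeCountFormula : ∀ d m → ∇[ suc d ] (latticeCountFormula d m) ≗ heightPolynomial d m
  ∇[]-latticeCountFormula d m n =
    trans (∇[]-sum (suc d) (λ p t → ∑[ w < m ] term p w t) n) (sum-cong-≗ λ p →
    trans (∇[]-sum (suc d) (term p) n) (sum-cong-≗ λ w →
    trans (∇[]-shift (suc d) (h p w) _ n) (shift-cong (h p w) (∇[]-simplexCount d) n)))
    where
    h : Fin d → Fin m → ℕ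
    h p w = height (toℕ p) (toℕ w)
    term : Fin d → Fin m → ℕ → ℤ
    term p w = shift (+ 0) (h p w) (+_ ∘ simplexCount d)

  ∑-const : ∀ k x → ∑[ i < k ] x ≡ + k * x
  ∑-const zero    x = refl
  ∑-const (suc k) x = trans (cong (λ s → x + s) (∑-const k x)) (sym (ℤP.suc-* (+ k) x))

  x^-height-suc : ∀ p w → x^ height (suc p) w ≗ shift (+ 0) 1 (x^ height p w)
  x^-height-suc p zero    zero    = refl
  x^-height-suc p zero    (suc n) = refl
  x^-height-suc p (suc w) zero    = refl
  x^-height-suc p (suc w) (suc n) = refl

  ∑-shift₁ : ∀ {k} (g : Fin k → ℕ → ℤ) →
    (λ n → ∑[ i < k ] shift (+ 0) 1 (g i) n) ≗ shift (+ 0) 1 (λ n → ∑[ i < k ] g i n)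
  ∑-shift₁ {k} g zero    = sum-replicate-zero k
  ∑-shift₁ {k} g (suc n) = refl

  layer : ℕ → ℕ → ℤ
  layer m′ n = (x^ 0) n + + m′ * (x^ 1) n

  layer-0 : ∀ m′ → layer m′ 0 ≡ + 1
  layer-0 m′ = cong (λ s → + 1 + s) (ℤP.*-zeroʳ (+ m′))

  layer-1 : ∀ m′ → layer m′ 1 ≡ + m′
  layer-1 m′ = trans (ℤP.+-identityˡ _) (ℤP.*-identityʳ (+ m′))

  layer-2+ : ∀ m′ n → layer m′ (suc (suc n)) ≡ + 0
  layer-2+ m′ n = trans (ℤP.+-identityˡ _) (ℤP.*-zeroʳ (+ m′))

  heightPolynomial-suc : ∀ d m′ →
    heightPolynomial (suc d) (suc m′) ≗ λ n → layer m′ n + shift (+ 0) 1 (heightPolynomial d (suc m′)) n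
  heightPolynomial-suc d m′ n = cong₂ _+_
    (cong (λ s → (x^ 0) n + s) (∑-const m′ ((x^ 1) n)))
    (trans (sum-cong-≗ {d} λ p → trans (sum-cong-≗ {suc m′} λ w → x^-height-suc (toℕ p) (toℕ w) n)
                                             (∑-shift₁ {suc m′} (λ w → x^ height (toℕ p) (toℕ w)) n))
           (∑-shift₁ {d} (λ p n → ∑[ w < suc m′ ] (x^ height (toℕ p) (toℕ w)) n) n))

  claimedCoeff-1 : ∀ m′ → claimedCoeff 1 (suc m′) ≗ λ n → layer m′ n + shift (+ 0) 1 (λ _ → + 0) n
  claimedCoeff-1 m′ zero          = sym (trans (ℤP.+-identityʳ _) (layer-0 m′))
  claimedCoeff-1 m′ (suc zero)    = sym (trans (ℤP.+-identityʳ _) (layer-1 m′))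
  claimedCoeff-1 m′ (suc (suc n)) = sym (trans (ℤP.+-identityʳ _) (layer-2+ m′ n))

  claimedCoeff-suc : ∀ e m′ →
    claimedCoeff (suc (suc e)) (suc m′) ≗ λ n → layer m′ n + shift (+ 0) 1 (claimedCoeff (suc e) (suc m′)) n
  claimedCoeff-suc e m′ zero          = sym (trans (ℤP.+-identityʳ _) (layer-0 m′))
  claimedCoeff-suc e m′ (suc zero)    = sym (trans (cong (_+ + 1) (layer-1 m′)) (ℤP.+-comm (+ m′) (+ 1)))
  claimedCoeff-suc e m′ (suc (suc n)) =
    sym (trans (cong (_+ claimedCoeff (suc e) (suc m′) (suc n)) (layer-2+ m′ n)) (ℤP.+-identityˡ _))

  heightPolynomial≗claimedCoeff : ∀ e m′ → heightPolynomial (suc e) (suc m′) ≗ claimedCoeff (suc e) (suc m′)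
  heightPolynomial≗claimedCoeff zero    m′ n = trans (heightPolynomial-suc 0 m′ n) (sym (claimedCoeff-1 m′ n))
  heightPolynomial≗claimedCoeff (suc e) m′ n = begin
    heightPolynomial (suc (suc e)) (suc m′) n
      ≡⟨ heightPolynomial-suc (suc e) m′ n ⟩
    layer m′ n + shift (+ 0) 1 (heightPolynomial (suc e) (suc m′)) n
      ≡⟨ cong (λ s → layer m′ n + s) (shift-cong 1 (heightPolynomial≗claimedCoeff e m′) n) ⟩
    layer m′ n + shift (+ 0) 1 (claimedCoeff (suc e) (suc m′)) n
      ≡⟨ claimedCoeff-suc e m′ n ⟨
    claimedCoeff (suc (suc e)) (suc m′) n ∎

module LatticePoints (e m′ : ℕ) where
  open import Data.Nat as ℕ using (suc; _<_; _∸_; z≤n)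
  import Data.Nat.Properties as ℕP
  open import Data.Nat.DivMod using (_/_; _%_; m≡m%n+[m/n]*n; m%n<n)
  open import Data.Integer as ℤ using (+_; _+_; _-_; _*_; +≤+; ∣_∣)
  import Data.Integer.Properties as ℤP
  open import Data.Integer.Tactic.RingSolver using (solve-∀)
  open import Data.Fin using (toℕ)
  open import Data.Fin.Relation.Unary.Top using (view; View; ‵fromℕ; ‵inject₁)
  open import Data.Vec using (Vec; []; _∷_; lookup; tabulate; sum)
  open import Data.Vec.Properties using (lookup∘tabulate)
  open import Data.Vec.Relation.Binary.Pointwise.Extensional using (ext; Pointwise-≡⇒≡)
  open import Data.List using (List; []; map; concat; applyUpTo; length)
  open import Data.List.Properties using (length-map)
  open import Data.List.Membership.Propositional using (_∈_)
  open import Data.List.Membership.Propositional.Properties using (∈-map⁺; ∈-map⁻)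
  open import Data.List.Relation.Unary.Unique.Propositional using (Unique)
  import Data.List.Relation.Unary.Unique.Propositional.Properties as Unique
  import Data.List.Relation.Unary.AllPairs as AllPairs
  open import Data.Product using (∃-syntax; _×_; _,_; proj₁; proj₂)
  open import Function.Bundles using (_⇔_; mk⇔; Equivalence)
  open import Algebra.Properties.Semiring.Sum ℤP.+-*-semiring using (sum-syntax; sum-cong-≗)
  open import Relation.Binary.PropositionalEquality
  open NatArithmetic
  open IntArithmetic
  open Enumeration
  open Sequences using (latticeCountFormula)

  d m M : ℕ
  d = suc e
  m = suc m′
  M = m ℕ.* d

  lastCoord : Vec ℤ d → ℤ
  lastCoord x = lookup x (fromℕ e)

  initCoord : Vec ℤ d → Fin e → ℤ
  initCoord x i = lookup x (inject₁ i)

  BaseFacet : ℕ → Vec ℤ d → Set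
  BaseFacet t x = + m * (∑[ i < e ] initCoord x i) + lastCoord x ℤ.≤ + m * + t

  FacetInequalities : ℕ → Vec ℤ d → Set
  FacetInequalities t x =
    + 0 ℤ.≤ lastCoord x × (∀ i → + 0 ℤ.≤ + M * initCoord x i + lastCoord x) × BaseFacet t x

  ≡-byCoords : ∀ {x x′ : Vec ℤ d} → lastCoord x ≡ lastCoord x′ → (∀ i → initCoord x i ≡ initCoord x′ i) → x ≡ x′
  ≡-byCoords {x} {x′} last≡ init≡ = Pointwise-≡⇒≡ (ext λ j → same (view j))
    where
    same : ∀ {j} → View j → lookup x j ≡ lookup x′ j
    same ‵fromℕ        = last≡
    same (‵inject₁ i) = init≡ i

  lastCoordOf : ℕ → ℕ → ℕ → ℕ
  lastCoordOf p w q = w ℕ.+ (p ℕ.+ q ℕ.* d) ℕ.* m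

  boxPoint : ℕ → ℕ → Vec ℕ d → Vec ℤ d
  boxPoint p w (q ∷ y) = tabulate ((λ i → + lookup y i - + q) ∷ʳ + lastCoordOf p w q)

  lastCoord-boxPoint : ∀ p w q y → lastCoord (boxPoint p w (q ∷ y)) ≡ + lastCoordOf p w q
  lastCoord-boxPoint p w q y =
    trans (lookup∘tabulate (init ∷ʳ + lastCoordOf p w q) (fromℕ e)) (∷ʳ-fromℕ init _)
    where
    init : Fin e → ℤ
    init i = + lookup y i - + q

  initCoord-boxPoint : ∀ p w q y i → initCoord (boxPoint p w (q ∷ y)) i ≡ + lookup y i - + q
  initCoord-boxPoint p w q y i =
    trans (lookup∘tabulate (init ∷ʳ + lastCoordOf p w q) (inject₁ i)) (∷ʳ-inject₁ init _ i)
    where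
    init : Fin e → ℤ
    init i = + lookup y i - + q

  lastCoordOf-injective : ∀ {p p′ w w′ q q′} → p < d → p′ < d → w < m → w′ < m →
    lastCoordOf p w q ≡ lastCoordOf p′ w′ q′ → p ≡ p′ × w ≡ w′ × q ≡ q′
  lastCoordOf-injective {p} {p′} {w} {w′} {q} {q′} p<d p′<d w<m w′<m eq
    with refl , j≡j′ ← +-*-injective m {p ℕ.+ q ℕ.* d} {p′ ℕ.+ q′ ℕ.* d} w<m w′<m eq
    with refl , refl ← +-*-injective d {q} {q′} p<d p′<d j≡j′
    = refl , refl , refl

  boxPoint-injective : ∀ {p p′ w w′ v v′} → p < d → p′ < d → w < m → w′ < m →
    boxPoint p w v ≡ boxPoint p′ w′ v′ → p ≡ p′ × w ≡ w′ × v ≡ v′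
  boxPoint-injective {p} {p′} {w} {w′} {q ∷ y} {q′ ∷ y′} p<d p′<d w<m w′<m eq =
    p≡p′ , w≡w′ , cong₂ _∷_ q≡q′ (Pointwise-≡⇒≡ (ext λ i → ℤP.+-injective (y≡y′ i)))
    where
    last≡ : lastCoordOf p w q ≡ lastCoordOf p′ w′ q′
    last≡ = ℤP.+-injective (begin
      + lastCoordOf p w q                   ≡⟨ lastCoord-boxPoint p w q y ⟨
      lastCoord (boxPoint p w (q ∷ y))      ≡⟨ cong lastCoord eq ⟩
      lastCoord (boxPoint p′ w′ (q′ ∷ y′))  ≡⟨ lastCoord-boxPoint p′ w′ q′ y′ ⟩
      + lastCoordOf p′ w′ q′                ∎)
      where open ≡-Reasoning
    pwq≡ : p ≡ p′ × w ≡ w′ × q ≡ q′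
    pwq≡ = lastCoordOf-injective {p} {p′} {w} {w′} {q} {q′} p<d p′<d w<m w′<m last≡
    p≡p′ : p ≡ p′
    p≡p′ = proj₁ pwq≡
    w≡w′ : w ≡ w′
    w≡w′ = proj₁ (proj₂ pwq≡)
    q≡q′ : q ≡ q′
    q≡q′ = proj₂ (proj₂ pwq≡)
    y≡y′ : ∀ i → + lookup y i ≡ + lookup y′ i
    y≡y′ i = begin
      + lookup y i                                   ≡⟨ i-j+j≡i (+ lookup y i) (+ q) ⟨
      + lookup y i - + q + + q                       ≡⟨ cong₂ (λ a b → a + + b) (sym (initCoord-boxPoint p w q y i)) q≡q′ ⟩
      initCoord (boxPoint p w (q ∷ y)) i + + q′      ≡⟨ cong (λ z → initCoord z i + + q′) eq ⟩
      initCoord (boxPoint p′ w′ (q′ ∷ y′)) i + + q′  ≡⟨ cong (_+ + q′) (initCoord-boxPoint p′ w′ q′ y′ i) ⟩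
      + lookup y′ i - + q′ + + q′                    ≡⟨ i-j+j≡i (+ lookup y′ i) (+ q′) ⟩
      + lookup y′ i                                  ∎
      where open ≡-Reasoning

  pos-lastCoordOf : ∀ p w q → + lastCoordOf p w q ≡ + w + (+ p + + q * + d) * + m
  pos-lastCoordOf p w q =
    trans (pos-+-* w (p ℕ.+ q ℕ.* d) m) (cong (λ z → + w + z * + m) (pos-+-* p q d))

  initFacet-identity : ∀ p w q z → + M * z + + lastCoordOf p w q ≡ + M * (z + + q) + + (w ℕ.+ p ℕ.* m)
  initFacet-identity p w q z = begin
    + M * z + + lastCoordOf p w q
      ≡⟨ cong₂ (λ a b → a * z + b) (ℤP.pos-* m d) (pos-lastCoordOf p w q) ⟩
    + m * + d * z + (+ w + (+ p + + q * + d) * + m)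
      ≡⟨ regroup (+ m) (+ d) (+ w) (+ p) (+ q) z ⟩
    + m * + d * (z + + q) + (+ w + + p * + m)
      ≡⟨ cong₂ (λ a b → a * (z + + q) + b) (ℤP.pos-* m d) (pos-+-* w p m) ⟨
    + M * (z + + q) + + (w ℕ.+ p ℕ.* m) ∎
    where
    open ≡-Reasoning
    regroup : ∀ m d w p q z → m * d * z + (w + (p + q * d) * m) ≡ m * d * (z + q) + (w + p * m)
    regroup = solve-∀

  ∑-shifted-lookup : ∀ {k} (y : Vec ℕ k) q → ∑[ i < k ] (+ lookup y i - + q) ≡ + sum y - + k * + q
  ∑-shifted-lookup []      q = refl
  ∑-shifted-lookup {suc k} (a ∷ y) q = begin
    + a - + q + ∑[ i < k ] (+ lookup y i - + q)
      ≡⟨ cong (λ s → + a - + q + s) (∑-shifted-lookup y q) ⟩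
    + a - + q + (+ sum y - + k * + q)
      ≡⟨ regroup (+ a) (+ sum y) (+ k) (+ q) ⟩
    + a + + sum y - (+ 1 + + k) * + q
      ≡⟨ cong (λ s → s - + suc k * + q) (ℤP.pos-+ a (sum y)) ⟨
    + sum (a ∷ y) - + suc k * + q ∎
    where
    open ≡-Reasoning
    regroup : ∀ a s k q → a - q + (s - k * q) ≡ a + s - (+ 1 + k) * q
    regroup = solve-∀

  baseFacet-identity : ∀ p w q (y : Vec ℕ e) →
    + m * (+ sum y - + e * + q) + + lastCoordOf p w q ≡ + (w ℕ.+ (q ℕ.+ sum y ℕ.+ p) ℕ.* m)
  baseFacet-identity p w q y = begin
    + m * (+ sum y - + e * + q) + + lastCoordOf p w q
      ≡⟨ cong (λ b → + m * (+ sum y - + e * + q) + b) (pos-lastCoordOf p w q) ⟩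
    + m * (+ sum y - + e * + q) + (+ w + (+ p + + q * (+ 1 + + e)) * + m)
      ≡⟨ regroup (+ m) (+ sum y) (+ e) (+ q) (+ w) (+ p) ⟩
    + w + (+ q + + sum y + + p) * + m
      ≡⟨ cong (λ s → + w + (s + + p) * + m) (ℤP.pos-+ q (sum y)) ⟨
    + w + (+ (q ℕ.+ sum y) + + p) * + m
      ≡⟨ cong (λ s → + w + s * + m) (ℤP.pos-+ (q ℕ.+ sum y) p) ⟨
    + w + + (q ℕ.+ sum y ℕ.+ p) * + m
      ≡⟨ pos-+-* w (q ℕ.+ sum y ℕ.+ p) m ⟨
    + (w ℕ.+ (q ℕ.+ sum y ℕ.+ p) ℕ.* m) ∎
    where
    open ≡-Reasoning
    regroup : ∀ m s e q w p → m * (s - e * q) + (w + (p + q * (+ 1 + e)) * m) ≡ w + (q + s + p) * m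
    regroup = solve-∀

  BoxParameters : ℕ → ℕ → ℕ → Vec ℕ d → Set
  BoxParameters t p w v = p < d × w < m × height p w ℕ.≤ t × sum v ℕ.≤ t ∸ height p w

  boxPoint-baseFacet⇔ : ∀ {t p w q y} → w < m →
    BaseFacet t (boxPoint p w (q ∷ y)) ⇔ (height p w ℕ.≤ t × q ℕ.+ sum y ℕ.≤ t ∸ height p w)
  boxPoint-baseFacet⇔ {t} {p} {w} {q} {y} w<m = mk⇔
    (λ facet → to (m+n≤o⇔n≤o×m≤o∸n s) (subst (ℕ._≤ t) (height-+ s p w)
                 (to (+-*-≤-*⇔height-≤ w<m) (ℤP.drop‿+≤+ (subst₂ ℤ._≤_ base≡ rhs≡ facet)))))
    (λ bounds → subst₂ ℤ._≤_ (sym base≡) (sym rhs≡) (+≤+ (from (+-*-≤-*⇔height-≤ w<m)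
                 (subst (ℕ._≤ t) (sym (height-+ s p w)) (from (m+n≤o⇔n≤o×m≤o∸n s) bounds)))))
    where
    open Equivalence
    s : ℕ
    s = q ℕ.+ sum y
    base≡ : + m * (∑[ i < e ] initCoord (boxPoint p w (q ∷ y)) i) + lastCoord (boxPoint p w (q ∷ y))
          ≡ + (w ℕ.+ (s ℕ.+ p) ℕ.* m)
    base≡ = trans (cong₂ (λ a b → + m * a + b)
                         (trans (sum-cong-≗ (initCoord-boxPoint p w q y)) (∑-shifted-lookup y q))
                         (lastCoord-boxPoint p w q y))
                  (baseFacet-identity p w q y)
    rhs≡ : + m * + t ≡ + (t ℕ.* m)
    rhs≡ = trans (sym (ℤP.pos-* m t)) (cong +_ (ℕP.*-comm m t))

  boxPoint-facets : ∀ {t p w v} → BoxParameters t p w v → FacetInequalities t (boxPoint p w v)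
  boxPoint-facets {t} {p} {w} {q ∷ y} (_ , w<m , h≤t , s≤t∸h) =
    subst (+ 0 ℤ.≤_) (sym (lastCoord-boxPoint p w q y)) (+≤+ z≤n) ,
    (λ i → subst (+ 0 ℤ.≤_) (sym (initFacet≡ i)) (+≤+ z≤n)) ,
    Equivalence.from (boxPoint-baseFacet⇔ {t} {p} {w} {q} {y} w<m) (h≤t , s≤t∸h)
    where
    open ≡-Reasoning
    initFacet≡ : ∀ i → + M * initCoord (boxPoint p w (q ∷ y)) i + lastCoord (boxPoint p w (q ∷ y))
                     ≡ + (M ℕ.* lookup y i ℕ.+ (w ℕ.+ p ℕ.* m))
    initFacet≡ i = begin
      + M * initCoord (boxPoint p w (q ∷ y)) i + lastCoord (boxPoint p w (q ∷ y))
        ≡⟨ cong₂ (λ a b → + M * a + b) (initCoord-boxPoint p w q y i) (lastCoord-boxPoint p w q y) ⟩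
      + M * (+ lookup y i - + q) + + lastCoordOf p w q
        ≡⟨ initFacet-identity p w q (+ lookup y i - + q) ⟩
      + M * (+ lookup y i - + q + + q) + + (w ℕ.+ p ℕ.* m)
        ≡⟨ cong (λ a → + M * a + + (w ℕ.+ p ℕ.* m)) (i-j+j≡i (+ lookup y i) (+ q)) ⟩
      + M * + lookup y i + + (w ℕ.+ p ℕ.* m)
        ≡⟨ cong (_+ + (w ℕ.+ p ℕ.* m)) (ℤP.pos-* M (lookup y i)) ⟨
      + (M ℕ.* lookup y i) + + (w ℕ.+ p ℕ.* m)
        ≡⟨ ℤP.pos-+ (M ℕ.* lookup y i) (w ℕ.+ p ℕ.* m) ⟨
      + (M ℕ.* lookup y i ℕ.+ (w ℕ.+ p ℕ.* m)) ∎

  lastCoordOf-surjective : ∀ K → ∃[ p ] ∃[ w ] ∃[ q ] p < d × w < m × K ≡ lastCoordOf p w q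
  lastCoordOf-surjective K = j % d , K % m , j / d , m%n<n j d , m%n<n K m , (begin
    K                                      ≡⟨ m≡m%n+[m/n]*n K m ⟩
    K % m ℕ.+ j ℕ.* m                      ≡⟨ cong (λ i → K % m ℕ.+ i ℕ.* m) (m≡m%n+[m/n]*n j d) ⟩
    K % m ℕ.+ (j % d ℕ.+ j / d ℕ.* d) ℕ.* m ∎)
    where
    open ≡-Reasoning
    j : ℕ
    j = K / m

  opaque
    facets⇒boxPoint : ∀ {t x} → FacetInequalities t x →
      ∃[ p ] ∃[ w ] ∃[ v ] BoxParameters t p w v × x ≡ boxPoint p w v
    facets⇒boxPoint {t} {x} (0≤last , 0≤init , base)
      with p , w , q , p<d , w<m , K≡ ← lastCoordOf-surjective ∣ lastCoord x ∣ =
      p , w , q ∷ y ,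
      (p<d , w<m , Equivalence.to (boxPoint-baseFacet⇔ {t} {p} {w} {q} {y} w<m) (subst (BaseFacet t) x≡ base)) ,
      x≡
      where
      open ≡-Reasoning
      last≡ : lastCoord x ≡ + lastCoordOf p w q
      last≡ = trans (sym (ℤP.0≤i⇒+∣i∣≡i 0≤last)) (cong +_ K≡)
      r<M : w ℕ.+ p ℕ.* m < M
      r<M = ℕP.<-≤-trans (ℕP.+-monoˡ-< (p ℕ.* m) w<m)
                         (subst (suc p ℕ.* m ℕ.≤_) (ℕP.*-comm d m) (ℕP.*-monoˡ-≤ m p<d))
      shifted≥0 : ∀ i → + 0 ℤ.≤ initCoord x i + + q
      shifted≥0 i = 0≤n*i+r⇒0≤i (initCoord x i + + q) r<M (subst (+ 0 ℤ.≤_)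
        (trans (cong (λ b → + M * initCoord x i + b) last≡) (initFacet-identity p w q (initCoord x i)))
        (0≤init i))
      y : Vec ℕ e
      y = tabulate λ i → ∣ initCoord x i + + q ∣
      x≡ : x ≡ boxPoint p w (q ∷ y)
      x≡ = ≡-byCoords (trans last≡ (sym (lastCoord-boxPoint p w q y))) λ i → begin
        initCoord x i                        ≡⟨ i+j-j≡i (initCoord x i) (+ q) ⟨
        initCoord x i + + q - + q            ≡⟨ cong (_- + q) (ℤP.0≤i⇒+∣i∣≡i (shifted≥0 i)) ⟨
        + ∣ initCoord x i + + q ∣ - + q      ≡⟨ cong (λ a → + a - + q) (lookup∘tabulate _ i) ⟨
        + lookup y i - + q                   ≡⟨ initCoord-boxPoint p w q y i ⟨
        initCoord (boxPoint p w (q ∷ y)) i   ∎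

  boxPointImage : ℕ → ℕ → ℕ → List (Vec ℤ d)
  boxPointImage p w n = map (boxPoint p w) (simplexPoints d n)

  boxPoints : ℕ → ℕ → ℕ → List (Vec ℤ d)
  boxPoints t p w = shift [] (height p w) (boxPointImage p w) t

  layerPoints : ℕ → ℕ → List (Vec ℤ d)
  layerPoints t p = concat (applyUpTo (boxPoints t p) m)

  latticePoints : ℕ → List (Vec ℤ d)
  latticePoints t = concat (applyUpTo (layerPoints t) d)

  opaque
    ∈-boxPoints⁻ : ∀ {t p w x} → x ∈ boxPoints t p w →
      ∃[ v ] height p w ℕ.≤ t × sum v ℕ.≤ t ∸ height p w × x ≡ boxPoint p w v
    ∈-boxPoints⁻ {t} {p} {w} x∈
      with h≤t , x∈image ← ∈-shift⁻ (height p w) (boxPointImage p w) t x∈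
      with v , v∈ , refl ← ∈-map⁻ (boxPoint p w) x∈image
      = v , h≤t , ∈-simplexPoints⁻ d _ v∈ , refl

    ∈-latticePoints⁻ : ∀ {t x} → x ∈ latticePoints t →
      ∃[ p ] ∃[ w ] ∃[ v ] BoxParameters t p w v × x ≡ boxPoint p w v
    ∈-latticePoints⁻ {t} x∈
      with p , p<d , x∈p ← ∈-concat-applyUpTo⁻ (layerPoints t) x∈
      with w , w<m , x∈pw ← ∈-concat-applyUpTo⁻ (boxPoints t p) x∈p
      with v , h≤t , s≤t∸h , x≡ ← ∈-boxPoints⁻ x∈pw
      = p , w , v , (p<d , w<m , h≤t , s≤t∸h) , x≡

  boxPoints-disjoint : ∀ {t p p′ w w′ x} → p < d → p′ < d → w < m → w′ < m →
    x ∈ boxPoints t p w → x ∈ boxPoints t p′ w′ → p ≡ p′ × w ≡ w′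
  boxPoints-disjoint {t} {p} {p′} {w} {w′} {x} p<d p′<d w<m w′<m x∈ x∈′
    with v , _ , _ , x≡ ← ∈-boxPoints⁻ {t} {p} {w} {x} x∈
    with v′ , _ , _ , x≡′ ← ∈-boxPoints⁻ {t} {p′} {w′} {x} x∈′
    with p≡p′ , w≡w′ , _ ← boxPoint-injective {p} {p′} {w} {w′} {v} {v′} p<d p′<d w<m w′<m (trans (sym x≡) x≡′)
    = p≡p′ , w≡w′

  latticePoints-unique : ∀ t → Unique (latticePoints t)
  latticePoints-unique t = concat-applyUpTo-unique (layerPoints t) d layer-unique same-layer
    where
    box-unique : ∀ {p w} → p < d → w < m → Unique (boxPoints t p w)
    box-unique {p} {w} p<d w<m = shift-preserves Unique AllPairs.[]
      (λ n → Unique.map⁺ (λ eq → proj₂ (proj₂ (boxPoint-injective p<d p<d w<m w<m eq))) (simplexPoints-unique d n))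
      (height p w) t
    layer-unique : ∀ {p} → p < d → Unique (layerPoints t p)
    layer-unique {p} p<d = concat-applyUpTo-unique (boxPoints t p) m (box-unique p<d)
      λ {w} {w′} {x} w<m w′<m x∈ x∈′ → proj₂ (boxPoints-disjoint {t} {p} {p} {w} {w′} {x} p<d p<d w<m w′<m x∈ x∈′)
    same-layer : ∀ {p p′ x} → p < d → p′ < d → x ∈ layerPoints t p → x ∈ layerPoints t p′ → p ≡ p′
    same-layer {p} {p′} {x} p<d p′<d x∈ x∈′
      with _ , w<m , x∈pw ← ∈-concat-applyUpTo⁻ (boxPoints t p) {x = x} x∈
      with _ , w′<m , x∈p′w′ ← ∈-concat-applyUpTo⁻ (boxPoints t p′) {x = x} x∈′
      = proj₁ (boxPoints-disjoint {t} {p} {p′} {_} {_} {x} p<d p′<d w<m w′<m x∈pw x∈p′w′)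

  length-latticePoints : ∀ t → + length (latticePoints t) ≡ latticeCountFormula d m t
  length-latticePoints t =
    trans (length-concat-applyUpTo (layerPoints t) d) (sum-cong-≗ {d} λ p →
    trans (length-concat-applyUpTo (boxPoints t (toℕ p)) m) (sum-cong-≗ {m} λ w →
    let h = height (toℕ p) (toℕ w) in
    trans (shift-natural (+_ ∘ length) {[]} h (boxPointImage (toℕ p) (toℕ w)) t)
          (shift-cong h (λ n → cong +_ (trans (length-map _ (simplexPoints d n)) (length-simplexPoints d n))) t)))

  ∈-latticePoints⁺ : ∀ {t p w v} → BoxParameters t p w v → boxPoint p w v ∈ latticePoints t
  ∈-latticePoints⁺ {t} {p} {w} {v} (p<d , w<m , h≤t , s≤t∸h) =
    ∈-concat-applyUpTo⁺ (layerPoints t) p<d (∈-concat-applyUpTo⁺ (boxPoints t p) w<m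
      (∈-shift⁺ (height p w) (boxPointImage p w) t h≤t (∈-map⁺ (boxPoint p w) (∈-simplexPoints⁺ d _ v s≤t∸h))))

  ∈-latticePoints⇔ : ∀ {t x} → x ∈ latticePoints t ⇔ FacetInequalities t x
  ∈-latticePoints⇔ {t} = mk⇔ facets-of-member member-of-facets
    where
    facets-of-member : ∀ {x} → x ∈ latticePoints t → FacetInequalities t x
    facets-of-member {x} x∈ with p , w , v , params , refl ← ∈-latticePoints⁻ {t} {x} x∈ =
      boxPoint-facets {t} {p} {w} {v} params
    member-of-facets : ∀ {x} → FacetInequalities t x → x ∈ latticePoints t
    member-of-facets {x} facets with p , w , v , params , refl ← facets⇒boxPoint {t} {x} facets =
      ∈-latticePoints⁺ {t} {p} {w} {v} params

module Barycentric (e m′ : ℕ) where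
  open import Level using (0ℓ)
  open import Data.Nat using (zero; suc; _≤ᵇ_)
  import Data.Nat.Properties as ℕP
  open import Data.Integer as ℤ using (+_; -[1+_])
  import Data.Integer.Properties as ℤP
  open import Data.Rational using (ℚ; 0ℚ; 1ℚ; _+_; _*_; -_; _-_; _≤_; 1/_; Positive; NonZero)
  import Data.Rational.Properties as ℚP
  open import Data.Rational.Solver using (module +-*-Solver)
  open import Data.Bool using (if_then_else_)
  open import Data.Fin using (toℕ)
  import Data.Fin.Properties as FinP
  open import Data.Fin.Relation.Unary.Top using (view; View; ‵fromℕ; ‵inject₁)
  open import Data.Vec using (Vec; lookup)
  open import Data.Vec.Properties using (lookup∘tabulate; lookup-replicate)
  open import Data.Product using (_×_; _,_; proj₂)
  open import Function.Bundles using (_⇔_; mk⇔; Equivalence)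
  open import Function.Properties.Equivalence using (⇔-setoid)
  open import Algebra.Bundles using (Ring)
  import Algebra.Properties.Semiring.Sum as SemiringSum
  open SemiringSum ℤP.+-*-semiring using () renaming (sum to ∑ℤ)
  open SemiringSum (Ring.semiring ℚP.+-*-ring)
    using (sum; sum-cong-≗; sum-init-last; ∑-distrib-+; sum-replicate-zero)
  open import Relation.Binary.PropositionalEquality
  open NatArithmetic using (≤ᵇ-true; ≤ᵇ-false)
  open Rationals
  open LatticePoints e m′ using (d; m; M; lastCoord; initCoord; BaseFacet; FacetInequalities)

  Δ : Fin (suc d) → Vec ℤ d
  Δ = ΔVertex d m

  kronecker : ℕ → ℕ → ℤ
  kronecker a b = if a ≤ᵇ b then (if b ≤ᵇ a then + 1 else + 0) else + 0

  kronecker-suc : ∀ a b → kronecker (suc a) (suc b) ≡ kronecker a b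
  kronecker-suc zero    zero    = refl
  kronecker-suc zero    (suc b) = refl
  kronecker-suc (suc a) zero    = refl
  kronecker-suc (suc a) (suc b) = refl

  ∑-kronecker : ∀ {n} (a : Fin n → ℚ) i → sum (λ j → a j * ι (kronecker (toℕ i) (toℕ j))) ≡ a i
  ∑-kronecker {suc n} a zero = begin
    a zero * 1ℚ + sum (λ j → a (suc j) * 0ℚ)
      ≡⟨ cong₂ _+_ (ℚP.*-identityʳ (a zero)) (sum-cong-≗ (λ j → ℚP.*-zeroʳ (a (suc j)))) ⟩
    a zero + sum {n} (λ _ → 0ℚ)
      ≡⟨ cong (λ s → a zero + s) (sum-replicate-zero n) ⟩
    a zero + 0ℚ
      ≡⟨ ℚP.+-identityʳ (a zero) ⟩
    a zero ∎
    where open ≡-Reasoning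
  ∑-kronecker {suc n} a (suc i) = begin
    a zero * 0ℚ + sum (λ j → a (suc j) * ι (kronecker (suc (toℕ i)) (suc (toℕ j))))
      ≡⟨ cong₂ _+_ (ℚP.*-zeroʳ (a zero))
                   (sum-cong-≗ λ j → cong (λ k → a (suc j) * ι k) (kronecker-suc (toℕ i) (toℕ j))) ⟩
    0ℚ + sum (λ j → a (suc j) * ι (kronecker (toℕ i) (toℕ j)))
      ≡⟨ ℚP.+-identityˡ _ ⟩
    sum (λ j → a (suc j) * ι (kronecker (toℕ i) (toℕ j)))
      ≡⟨ ∑-kronecker (a ∘ suc) i ⟩
    a (suc i) ∎
    where open ≡-Reasoning

  Δ-origin : ∀ i → lookup (Δ zero) i ≡ + 0
  Δ-origin i = lookup-replicate i (+ 0)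

  vertexEntry : Fin d → Fin d → ℤ
  vertexEntry j i =
    if suc (toℕ j) ≤ᵇ e
    then (if toℕ i ≤ᵇ toℕ j then (if toℕ j ≤ᵇ toℕ i then + 1 else + 0) else + 0)
    else (if suc (toℕ i) ≤ᵇ e then -[1+ 0 ] else + M)

  lookup-Δ-suc : ∀ j i → lookup (Δ (suc j)) i ≡ vertexEntry j i
  lookup-Δ-suc j = lookup∘tabulate (vertexEntry j)

  Δ-edge-init : ∀ j i → lookup (Δ (suc (inject₁ j))) (inject₁ i) ≡ kronecker (toℕ i) (toℕ j)
  Δ-edge-init j i = trans (lookup-Δ-suc (inject₁ j) (inject₁ i)) entry
    where
    entry : vertexEntry (inject₁ j) (inject₁ i) ≡ kronecker (toℕ i) (toℕ j)
    entry rewrite FinP.toℕ-inject₁ j | FinP.toℕ-inject₁ i | ≤ᵇ-true (FinP.toℕ<n j) = refl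

  Δ-edge-last : ∀ j → lookup (Δ (suc (inject₁ j))) (fromℕ e) ≡ + 0
  Δ-edge-last j = trans (lookup-Δ-suc (inject₁ j) (fromℕ e)) entry
    where
    entry : vertexEntry (inject₁ j) (fromℕ e) ≡ + 0
    entry rewrite FinP.toℕ-inject₁ j | FinP.toℕ-fromℕ e
                | ≤ᵇ-true (FinP.toℕ<n j) | ≤ᵇ-false {e} {toℕ j} (FinP.toℕ<n j) = refl

  Δ-apex-init : ∀ i → lookup (Δ (suc (fromℕ e))) (inject₁ i) ≡ -[1+ 0 ]
  Δ-apex-init i = trans (lookup-Δ-suc (fromℕ e) (inject₁ i)) entry
    where
    entry : vertexEntry (fromℕ e) (inject₁ i) ≡ -[1+ 0 ]
    entry rewrite FinP.toℕ-inject₁ i | FinP.toℕ-fromℕ e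
                | ≤ᵇ-false {suc e} {e} (ℕP.n<1+n e) | ≤ᵇ-true (FinP.toℕ<n i) = refl

  Δ-apex-last : lookup (Δ (suc (fromℕ e))) (fromℕ e) ≡ + M
  Δ-apex-last = trans (lookup-Δ-suc (fromℕ e) (fromℕ e)) entry
    where
    entry : vertexEntry (fromℕ e) (fromℕ e) ≡ + M
    entry rewrite FinP.toℕ-fromℕ e | ≤ᵇ-false {suc e} {e} (ℕP.n<1+n e) = refl

  vertex : Fin (suc d) → Fin d → ℚ
  vertex j i = ι (lookup (Δ j) i)

  combination : (Fin (suc d) → ℚ) → Fin d → ℚ
  combination λs i = sumℚ (λ j → λs j * vertex j i)

  edgeWeight : (Fin (suc d) → ℚ) → Fin e → ℚ
  edgeWeight λs i = λs (suc (inject₁ i))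

  apexWeight : (Fin (suc d) → ℚ) → ℚ
  apexWeight λs = λs (suc (fromℕ e))

  combination-split : ∀ λs i → combination λs i ≡
    λs zero * vertex zero i +
    (sum (λ j → edgeWeight λs j * vertex (suc (inject₁ j)) i) + apexWeight λs * vertex (suc (fromℕ e)) i)
  combination-split λs i = trans (sumℚ≡sum (λ j → λs j * vertex j i))
    (cong (λ s → λs zero * vertex zero i + s) (sum-init-last (λ j → λs (suc j) * vertex (suc j) i)))

  combination-init : ∀ λs i → combination λs (inject₁ i) ≡ edgeWeight λs i - apexWeight λs
  combination-init λs i = begin
    combination λs (inject₁ i)
      ≡⟨ combination-split λs (inject₁ i) ⟩
    λs zero * vertex zero (inject₁ i) +
    (sum (λ j → edgeWeight λs j * vertex (suc (inject₁ j)) (inject₁ i)) +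
     apexWeight λs * vertex (suc (fromℕ e)) (inject₁ i))
      ≡⟨ cong₂ (λ a b → λs zero * ι a + b) (Δ-origin (inject₁ i))
          (cong₂ _+_ (sum-cong-≗ λ j → cong (λ k → edgeWeight λs j * ι k) (Δ-edge-init j i))
                     (cong (λ k → apexWeight λs * ι k) (Δ-apex-init i))) ⟩
    λs zero * 0ℚ + (sum (λ j → edgeWeight λs j * ι (kronecker (toℕ i) (toℕ j))) + apexWeight λs * - 1ℚ)
      ≡⟨ cong₂ _+_ (ℚP.*-zeroʳ (λs zero))
                   (cong₂ _+_ (∑-kronecker (edgeWeight λs) i) (sym (ℚP.neg-distribʳ-* (apexWeight λs) 1ℚ))) ⟩
    0ℚ + (edgeWeight λs i + - (apexWeight λs * 1ℚ))
      ≡⟨ trans (ℚP.+-identityˡ _) (cong (λ a → edgeWeight λs i - a) (ℚP.*-identityʳ (apexWeight λs))) ⟩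
    edgeWeight λs i - apexWeight λs ∎
    where open ≡-Reasoning

  combination-last : ∀ λs → combination λs (fromℕ e) ≡ apexWeight λs * ι (+ M)
  combination-last λs = begin
    combination λs (fromℕ e)
      ≡⟨ combination-split λs (fromℕ e) ⟩
    λs zero * vertex zero (fromℕ e) +
    (sum (λ j → edgeWeight λs j * vertex (suc (inject₁ j)) (fromℕ e)) +
     apexWeight λs * vertex (suc (fromℕ e)) (fromℕ e))
      ≡⟨ cong₂ (λ a b → λs zero * ι a + b) (Δ-origin (fromℕ e))
          (cong₂ _+_ (sum-cong-≗ λ j → trans (cong (λ k → edgeWeight λs j * ι k) (Δ-edge-last j)) (ℚP.*-zeroʳ (edgeWeight λs j)))
                     (cong (λ k → apexWeight λs * ι k) Δ-apex-last)) ⟩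
    λs zero * 0ℚ + (sum {e} (λ _ → 0ℚ) + apexWeight λs * ι (+ M))
      ≡⟨ cong₂ _+_ (ℚP.*-zeroʳ (λs zero)) (cong (_+ apexWeight λs * ι (+ M)) (sum-replicate-zero e)) ⟩
    0ℚ + (0ℚ + apexWeight λs * ι (+ M))
      ≡⟨ trans (ℚP.+-identityˡ _) (ℚP.+-identityˡ _) ⟩
    apexWeight λs * ι (+ M) ∎
    where open ≡-Reasoning

  Solves : (Fin (suc d) → ℚ) → Vec ℤ d → Set
  Solves λs x =
    (∀ i → ι (initCoord x i) ≡ edgeWeight λs i - apexWeight λs) × ι (lastCoord x) ≡ apexWeight λs * ι (+ M)

  combination⇔Solves : ∀ {λs x} → (∀ i → ι (lookup x i) ≡ combination λs i) ⇔ Solves λs x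
  combination⇔Solves {λs} {x} = mk⇔
    (λ x≡ → (λ i → trans (x≡ (inject₁ i)) (combination-init λs i)) , trans (x≡ (fromℕ e)) (combination-last λs))
    (λ solves i → coordinate solves (view i))
    where
    coordinate : ∀ {i} → Solves λs x → View i → ι (lookup x i) ≡ combination λs i
    coordinate (_ , last≡)     ‵fromℕ        = trans last≡ (sym (combination-last λs))
    coordinate (init≡ , _)     (‵inject₁ i) = trans (init≡ i) (sym (combination-init λs i))

  sumℚ-split : ∀ λs → sumℚ λs ≡ λs zero + (sum (edgeWeight λs) + apexWeight λs)
  sumℚ-split λs = trans (sumℚ≡sum λs) (cong (λ s → λs zero + s) (sum-init-last (λs ∘ suc)))

  open +-*-Solver using (solve; _:+_; _:*_; _:-_; :-_; _:=_; con)

  initFacet≡ : ∀ {λs x} → Solves λs x → ∀ i →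
    ι (+ M ℤ.* initCoord x i ℤ.+ lastCoord x) ≡ ι (+ M) * edgeWeight λs i
  initFacet≡ {λs} {x} (init≡ , last≡) i = begin
    ι (+ M ℤ.* initCoord x i ℤ.+ lastCoord x)
      ≡⟨ trans (ι-+ (+ M ℤ.* initCoord x i) (lastCoord x)) (cong (_+ ι (lastCoord x)) (ι-* (+ M) (initCoord x i))) ⟩
    ι (+ M) * ι (initCoord x i) + ι (lastCoord x)
      ≡⟨ cong₂ (λ a b → ι (+ M) * a + b) (init≡ i) last≡ ⟩
    ι (+ M) * (edgeWeight λs i - apexWeight λs) + apexWeight λs * ι (+ M)
      ≡⟨ solve 3 (λ μ a b → μ :* (a :- b) :+ b :* μ := μ :* a) refl (ι (+ M)) (edgeWeight λs i) (apexWeight λs) ⟩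
    ι (+ M) * edgeWeight λs i ∎
    where open ≡-Reasoning

  baseFacet≡ : ∀ {λs x} → Solves λs x →
    ι (+ m ℤ.* ∑ℤ (initCoord x) ℤ.+ lastCoord x) ≡ ι (+ m) * (sum (edgeWeight λs) + apexWeight λs)
  baseFacet≡ {λs} {x} (init≡ , last≡) = begin
    ι (+ m ℤ.* ∑ℤ (initCoord x) ℤ.+ lastCoord x)
      ≡⟨ trans (ι-+ (+ m ℤ.* ∑ℤ (initCoord x)) (lastCoord x))
               (cong (_+ ι (lastCoord x))
                     (trans (ι-* (+ m) (∑ℤ (initCoord x))) (cong (ι (+ m) *_) (ι-sum (initCoord x))))) ⟩
    ι (+ m) * sum (ι ∘ initCoord x) + ι (lastCoord x)
      ≡⟨ cong₂ (λ a b → ι (+ m) * a + b) (sum-cong-≗ init≡) (trans last≡ (cong (apexWeight λs *_) ιM≡)) ⟩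
    ι (+ m) * sum (λ i → edgeWeight λs i - apexWeight λs) + apexWeight λs * (ι (+ m) * (1ℚ + ι (+ e)))
      ≡⟨ cong (λ s → ι (+ m) * s + apexWeight λs * (ι (+ m) * (1ℚ + ι (+ e))))
              (trans (∑-distrib-+ (edgeWeight λs) (λ _ → - apexWeight λs))
                     (cong (λ s → sum (edgeWeight λs) + s) (∑-const e (- apexWeight λs)))) ⟩
    ι (+ m) * (sum (edgeWeight λs) + ι (+ e) * - apexWeight λs) + apexWeight λs * (ι (+ m) * (1ℚ + ι (+ e)))
      ≡⟨ solve 4 (λ μ E ε a → μ :* (E :+ ε :* (:- a)) :+ a :* (μ :* (con 1ℚ :+ ε)) := μ :* (E :+ a)) refl
               (ι (+ m)) (sum (edgeWeight λs)) (ι (+ e)) (apexWeight λs) ⟩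
    ι (+ m) * (sum (edgeWeight λs) + apexWeight λs) ∎
    where
    open ≡-Reasoning
    ιM≡ : ι (+ M) ≡ ι (+ m) * (1ℚ + ι (+ e))
    ιM≡ = trans (cong ι (ℤP.pos-* m d)) (trans (ι-* (+ m) (+ d)) (cong (ι (+ m) *_) (ι-+ (+ 1) (+ e))))

  instance
    ιM-positive : Positive (ι (+ M))
    ιM-positive = ι-positive M

    ιm-positive : Positive (ι (+ m))
    ιm-positive = ι-positive m

  origin≡ : ∀ {λs t} → sumℚ λs ≡ ι (+ t) → λs zero ≡ ι (+ t) - (sum (edgeWeight λs) + apexWeight λs)
  origin≡ {λs} sum≡t = trans (solve 2 (λ o s → o := (o :+ s) :- s) refl (λs zero) S)
                             (cong (_- S) (trans (sym (sumℚ-split λs)) sum≡t))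
    where
    S : ℚ
    S = sum (edgeWeight λs) + apexWeight λs

  module _ {λs x} (solves : Solves λs x) where
    open import Relation.Binary.Reasoning.Setoid (⇔-setoid 0ℓ)

    lastFacet⇔ : + 0 ℤ.≤ lastCoord x ⇔ 0ℚ ≤ apexWeight λs
    lastFacet⇔ = begin
      + 0 ℤ.≤ lastCoord x            ≈⟨ ι-≤⇔ ⟩
      0ℚ ≤ ι (lastCoord x)           ≡⟨ cong (0ℚ ≤_) (trans (proj₂ solves) (ℚP.*-comm (apexWeight λs) (ι (+ M)))) ⟩
      0ℚ ≤ ι (+ M) * apexWeight λs   ≈⟨ 0≤*⇔0≤ (ι (+ M)) ⟩
      0ℚ ≤ apexWeight λs             ∎

    initFacet⇔ : ∀ i → + 0 ℤ.≤ + M ℤ.* initCoord x i ℤ.+ lastCoord x ⇔ 0ℚ ≤ edgeWeight λs i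
    initFacet⇔ i = begin
      + 0 ℤ.≤ + M ℤ.* initCoord x i ℤ.+ lastCoord x     ≈⟨ ι-≤⇔ ⟩
      0ℚ ≤ ι (+ M ℤ.* initCoord x i ℤ.+ lastCoord x)    ≡⟨ cong (0ℚ ≤_) (initFacet≡ {λs} {x} solves i) ⟩
      0ℚ ≤ ι (+ M) * edgeWeight λs i                    ≈⟨ 0≤*⇔0≤ (ι (+ M)) ⟩
      0ℚ ≤ edgeWeight λs i                              ∎

    baseFacet⇔ : ∀ {t} → sumℚ λs ≡ ι (+ t) → BaseFacet t x ⇔ 0ℚ ≤ λs zero
    baseFacet⇔ {t} sum≡t = begin
      BaseFacet t x                                  ≈⟨ ι-≤⇔ ⟩
      ι (+ m ℤ.* ∑ℤ (initCoord x) ℤ.+ lastCoord x) ≤ ι (+ m ℤ.* + t)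
        ≡⟨ cong₂ _≤_ (baseFacet≡ {λs} {x} solves) (ι-* (+ m) (+ t)) ⟩
      ι (+ m) * S ≤ ι (+ m) * ι (+ t)                ≈⟨ *-≤-*⇔ (ι (+ m)) ⟩
      S ≤ ι (+ t)                                    ≈⟨ ≤⇔0≤- ⟩
      0ℚ ≤ ι (+ t) - S                               ≡⟨ cong (0ℚ ≤_) (origin≡ {λs} {t} sum≡t) ⟨
      0ℚ ≤ λs zero                                   ∎
      where
      S : ℚ
      S = sum (edgeWeight λs) + apexWeight λs

    facets⇔nonnegative : ∀ {t} → sumℚ λs ≡ ι (+ t) → FacetInequalities t x ⇔ (∀ j → 0ℚ ≤ λs j)
    facets⇔nonnegative sum≡t = mk⇔
      (λ (last≥0 , init≥0 , base) → λ where
        zero    → to (baseFacet⇔ sum≡t) base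
        (suc j) → weight (view j) last≥0 init≥0)
      (λ λs≥0 → from lastFacet⇔ (λs≥0 (suc (fromℕ e))) ,
                (λ i → from (initFacet⇔ i) (λs≥0 (suc (inject₁ i)))) ,
                from (baseFacet⇔ sum≡t) (λs≥0 zero))
      where
      open Equivalence
      weight : ∀ {j} → View j → + 0 ℤ.≤ lastCoord x →
        (∀ i → + 0 ℤ.≤ + M ℤ.* initCoord x i ℤ.+ lastCoord x) → 0ℚ ≤ λs (suc j)
      weight ‵fromℕ        last≥0 _      = to lastFacet⇔ last≥0
      weight (‵inject₁ i) _      init≥0 = to (initFacet⇔ i) (init≥0 i)

  instance
    ιM-nonZero : NonZero (ι (+ M))
    ιM-nonZero = ℚP.pos⇒nonZero (ι (+ M))

  apexWeightOf : Vec ℤ d → ℚ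
  apexWeightOf x = ι (lastCoord x) * 1/ ι (+ M)

  edgeWeightOf : Vec ℤ d → Fin e → ℚ
  edgeWeightOf x i = ι (initCoord x i) + apexWeightOf x

  weightsOf : ℕ → Vec ℤ d → Fin (suc d) → ℚ
  weightsOf t x zero    = ι (+ t) - (sum (edgeWeightOf x) + apexWeightOf x)
  weightsOf t x (suc j) = (edgeWeightOf x ∷ʳ apexWeightOf x) j

  opaque
    weightsOf-solves : ∀ t x → Solves (weightsOf t x) x
    weightsOf-solves t x = init≡ , last≡
      where
      open ≡-Reasoning
      a : ℚ
      a = apexWeightOf x
      init≡ : ∀ i → ι (initCoord x i) ≡ edgeWeight (weightsOf t x) i - apexWeight (weightsOf t x)
      init≡ i = begin
        ι (initCoord x i)                    ≡⟨ solve 2 (λ z a → z := (z :+ a) :- a) refl (ι (initCoord x i)) a ⟩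
        edgeWeightOf x i - a                 ≡⟨ cong₂ _-_ (∷ʳ-inject₁ (edgeWeightOf x) a i) (∷ʳ-fromℕ (edgeWeightOf x) a) ⟨
        edgeWeight (weightsOf t x) i - apexWeight (weightsOf t x) ∎
      last≡ : ι (lastCoord x) ≡ apexWeight (weightsOf t x) * ι (+ M)
      last≡ = begin
        ι (lastCoord x)                          ≡⟨ ℚP.*-identityʳ (ι (lastCoord x)) ⟨
        ι (lastCoord x) * 1ℚ                     ≡⟨ cong (ι (lastCoord x) *_) (ℚP.*-inverseˡ (ι (+ M))) ⟨
        ι (lastCoord x) * (1/ ι (+ M) * ι (+ M)) ≡⟨ ℚP.*-assoc (ι (lastCoord x)) (1/ ι (+ M)) (ι (+ M)) ⟨
        a * ι (+ M)                              ≡⟨ cong (_* ι (+ M)) (∷ʳ-fromℕ (edgeWeightOf x) a) ⟨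
        apexWeight (weightsOf t x) * ι (+ M)     ∎

    weightsOf-sum : ∀ t x → sumℚ (weightsOf t x) ≡ ι (+ t)
    weightsOf-sum t x = begin
      sumℚ (weightsOf t x)
        ≡⟨ sumℚ-split (weightsOf t x) ⟩
      ι (+ t) - S + (sum (edgeWeight (weightsOf t x)) + apexWeight (weightsOf t x))
        ≡⟨ cong (λ s → ι (+ t) - S + s) (cong₂ _+_ (sum-cong-≗ (∷ʳ-inject₁ (edgeWeightOf x) (apexWeightOf x)))
                                                    (∷ʳ-fromℕ (edgeWeightOf x) (apexWeightOf x))) ⟩
      ι (+ t) - S + S
        ≡⟨ solve 2 (λ τ s → τ :- s :+ s := τ) refl (ι (+ t)) S ⟩
      ι (+ t) ∎
      where
      open ≡-Reasoning
      S : ℚ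
      S = sum (edgeWeightOf x) + apexWeightOf x

  InDilate⇔facets : ∀ {t x} → InDilate Δ t x ⇔ FacetInequalities t x
  InDilate⇔facets {t} {x} = mk⇔
    (λ (λs , λs≥0 , sum≡t , x≡) →
      from (facets⇔nonnegative {λs} {x} (to (combination⇔Solves {λs} {x}) x≡) sum≡t) λs≥0)
    (λ facets → weightsOf t x ,
      to (facets⇔nonnegative {weightsOf t x} {x} (weightsOf-solves t x) (weightsOf-sum t x)) facets ,
      weightsOf-sum t x ,
      from (combination⇔Solves {weightsOf t x} {x}) (weightsOf-solves t x))
    where open Equivalence

open import Data.Nat using (_≤_)
open import Data.Integer using (+_)
open import Data.Vec using (Vec)
open import Data.Product using (Σ; _×_; _,_)
open import Data.List using (length)
open import Data.List.Membership.Propositional using (_∈_)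
open import Function.Bundles using (_⇔_)
open import Function.Properties.Equivalence using () renaming (trans to ⇔-trans; sym to ⇔-sym)
open import Relation.Binary.PropositionalEquality using (sym; trans; module ≡-Reasoning)
open Enumeration using (length-unique-≡)
open Sequences

LatticeCount-functional : ∀ {d k} (V : Fin k → Vec ℤ d) t {n n′} →
  LatticeCount V t n → LatticeCount V t n′ → n ≡ n′
LatticeCount-functional V t (xs , xs! , refl , xs⇔) (ys , ys! , refl , ys⇔) =
  length-unique-≡ xs! ys! λ {x} → ⇔-trans (xs⇔ x) (⇔-sym (ys⇔ x))

module _ (e m′ : ℕ) where
  open LatticePoints e m′ using (latticePoints; latticePoints-unique; length-latticePoints; ∈-latticePoints⇔)
  open Barycentric e m′ using (Δ; InDilate⇔facets)

  latticePoints-count : ∀ t → LatticeCount Δ t (length (latticePoints t))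
  latticePoints-count t = latticePoints t , latticePoints-unique t , refl ,
    λ x → ⇔-trans (∈-latticePoints⇔ {t} {x}) (⇔-sym (InDilate⇔facets {t} {x}))

  seqA≗latticeCountFormula : ∀ i → (∀ t → LatticeCount Δ (suc t) (i (suc t))) →
    seqA i ≗ latticeCountFormula (suc e) (suc m′)
  -- ∇ does not change the value at 0, and h*₀ = 1.
  seqA≗latticeCountFormula i counted zero    = sym (begin
    latticeCountFormula (suc e) (suc m′) 0                        ≡⟨ ∇[]-at-0 (suc (suc e)) _ ⟨
    ∇[ suc (suc e) ] (latticeCountFormula (suc e) (suc m′)) 0     ≡⟨ ∇[]-latticeCountFormula (suc e) (suc m′) 0 ⟩
    heightPolynomial (suc e) (suc m′) 0                           ≡⟨ heightPolynomial≗claimedCoeff e m′ 0 ⟩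
    + 1                                                           ∎)
    where open ≡-Reasoning
  seqA≗latticeCountFormula i counted (suc t) =
    trans (cong +_ (LatticeCount-functional Δ (suc t) (counted t) (latticePoints-count (suc t))))
          (length-latticePoints (suc t))

corollary5p6 : (d m : ℕ) → 2 ≤ d → 1 ≤ m →
    ((t : ℕ) → Σ ℕ (λ n → LatticeCount (ΔVertex d m) t n)) ×
    ((i : ℕ → ℕ) → ((t : ℕ) → LatticeCount (ΔVertex d m) (suc t) (i (suc t))) →
      (n : ℕ) → hstarCoeffFromSeries d i n ≡ claimedCoeff d m n)
corollary5p6 (suc e) (suc m′) _ _ = (λ t → _ , latticePoints-count e m′ t) , hstar
  where
  open ≡-Reasoning
  hstar : (i : ℕ → ℕ) → ((t : ℕ) → LatticeCount (ΔVertex (suc e) (suc m′)) (suc t) (i (suc t))) →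
    (n : ℕ) → hstarCoeffFromSeries (suc e) i n ≡ claimedCoeff (suc e) (suc m′) n
  hstar i counted n = begin
    hstarCoeffFromSeries (suc e) i n
      ≡⟨ [1-x]^·≗∇[] (suc (suc e)) (seqA i) n ⟩
    ∇[ suc (suc e) ] (seqA i) n
      ≡⟨ ∇[]-cong (suc (suc e)) (seqA≗latticeCountFormula e m′ i counted) n ⟩
    ∇[ suc (suc e) ] (latticeCountFormula (suc e) (suc m′)) n
      ≡⟨ ∇[]-latticeCountFormula (suc e) (suc m′) n ⟩
    heightPolynomial (suc e) (suc m′) n
      ≡⟨ heightPolynomial≗claimedCoeff e m′ n ⟩
    claimedCoeff (suc e) (suc m′) n ∎
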